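{- Let $\Lambda_h=\begin{bmatrix}1&-\frac12\\0&\frac{\sqrt3}{2}\end{bmatrix}\mathbb{Z}^2$ and let $\mathfrak{I}$ be the set of all values of the index $|\Lambda_h:\Gamma|$ as $\Gamma$ ranges over well-rounded sublattices of $\Lambda_h$. Then $$\mathfrak{I}=\Big\{3^u j^2 d(2m-n)n:\ u\in\{0,1\},\ j,d,m,n\in\mathbb{Z}_{>0},\ d=1\text{ or }d\text{ is a product of distinct primes }\equiv1\ (\mathrm{mod}\ 3),\ \gcd(m,n)=1,\ 3\nmid(m+n),\ 1\le\tfrac mn\le2\Big\}.$$
   Context: For a lattice $\Gamma\subset\mathbb{R}^2$, $|\Gamma|=\min\{\|y\|^2:y\in\Gamma\setminus\{0\}\}$; $\Gamma$ is well-rounded if it has a basis consisting of two vectors attaining this minimum. $|\Lambda_h:\Gamma|=\det\Gamma/\det\Lambda_h$ is the index of a sublattice. -}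

module Defs where

open import Data.Nat as ℕ using (ℕ; _%_; _^_; _∸_)
open import Data.Nat.Divisibility using (_∣_)
open import Data.Nat.ListAction using (product)
open import Data.Nat.GCD using (gcd)
open import Data.Nat.Primality using (Prime)
open import Data.Integer as ℤ using (ℤ; ∣_∣)
open import Data.Product using (Σ; ∃; _×_; _,_)
open import Data.Sum using (_⊎_)
open import Data.List using (List)
open import Data.List.Relation.Unary.All using (All)
open import Data.List.Relation.Unary.Unique.Propositional using (Unique)
open import Relation.Binary.PropositionalEquality using (_≡_; _≢_)
open import Relation.Nullary using (¬_)

-- A point of Λ_h = M ℤ², M = [[1, -1/2],[0, √3/2]], is recorded by its
-- integer coordinate vector (a , b) ∈ ℤ², i.e. the point M (a , b)ᵀ.
V : Set
V = ℤ × ℤ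

-- squared Euclidean norm of M (a,b)ᵀ :  a² - ab + b²
‖_‖² : V → ℤ
‖ (a , b) ‖² = a ℤ.* a ℤ.- a ℤ.* b ℤ.+ b ℤ.* b

0V : V
0V = (ℤ.0ℤ , ℤ.0ℤ)

_+V_ : V → V → V
(a , b) +V (c , d) = (a ℤ.+ c , b ℤ.+ d)

_·V_ : ℤ → V → V
s ·V (a , b) = (s ℤ.* a , s ℤ.* b)

det : V → V → ℤ
det (a , b) (c , d) = a ℤ.* d ℤ.- b ℤ.* c

record Sublattice : Set where
  constructor ⟨_,_∣_⟩
  field
    v₁ v₂  : V
    nondeg : det v₁ v₂ ≢ ℤ.0ℤ
open Sublattice public

_∈_ : V → Sublattice → Set
x ∈ Γ = ∃ λ s → ∃ λ t → x ≡ (s ·V v₁ Γ) +V (t ·V v₂ Γ)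

-- |Λ_h : Γ| = det Γ / det Λ_h = |det of the coordinate matrix of a basis|
index : Sublattice → ℕ
index Γ = ∣ det (v₁ Γ) (v₂ Γ) ∣

IsBasisOf : V → V → Sublattice → Set
IsBasisOf w₁ w₂ Γ =
  w₁ ∈ Γ × w₂ ∈ Γ ×
  (∀ x → x ∈ Γ → ∃ λ s → ∃ λ t → x ≡ (s ·V w₁) +V (t ·V w₂))

IsMinNorm : Sublattice → ℤ → Set
IsMinNorm Γ m =
  (∃ λ y → y ∈ Γ × y ≢ 0V × ‖ y ‖² ≡ m) ×
  (∀ y → y ∈ Γ → y ≢ 0V → m ℤ.≤ ‖ y ‖²)

WellRounded : Sublattice → Set
WellRounded Γ = ∃ λ w₁ → ∃ λ w₂ →
  IsBasisOf w₁ w₂ Γ × IsMinNorm Γ ‖ w₁ ‖² × IsMinNorm Γ ‖ w₂ ‖²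

InIndexSet : ℕ → Set
InIndexSet N = ∃ λ (Γ : Sublattice) → WellRounded Γ × index Γ ≡ N

DistinctPrimes1mod3Product : ℕ → Set
DistinctPrimes1mod3Product d =
  d ≡ 1 ⊎
  (∃ λ (ps : List ℕ) → All Prime ps × Unique ps × All (λ p → p % 3 ≡ 1) ps
                       × product ps ≡ d)

InFormulaSet : ℕ → Set
InFormulaSet N =
  ∃ λ u → ∃ λ j → ∃ λ d → ∃ λ m → ∃ λ n →
    (u ≡ 0 ⊎ u ≡ 1) ×
    1 ℕ.≤ j × 1 ℕ.≤ d × 1 ℕ.≤ m × 1 ℕ.≤ n ×
    DistinctPrimes1mod3Product d ×
    gcd m n ≡ 1 ×
    ¬ (3 ∣ (m ℕ.+ n)) ×
    n ℕ.≤ m × m ℕ.≤ 2 ℕ.* n ×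
    N ≡ 3 ^ u ℕ.* (j ℕ.* j) ℕ.* d ℕ.* (2 ℕ.* m ∸ n) ℕ.* n

{-# OPTIONS --safe #-}
-- Gauss reduction: a sublattice is well rounded iff it has a basis x, y with
-- ‖x‖ = ‖y‖ ≤ ‖x ± y‖; then its index N = |det(x, y)| and k = ‖x‖² satisfy
-- ‖x - y‖² + ‖x + y‖² = 4k and ‖x - y‖² ‖x + y‖² = 3N², and in the coordinates of Λ_h
-- k = a² - ab + b² is the norm of an Eisenstein integer a + bω.  Splitting off
-- gcd(N, ‖x + y‖²) gives {‖x ∓ y‖²} = {3fs², ft²} with N = fst and s, t coprime, and the
-- substitution (m, n) = ((s + t)/2, s) or (s + t, 2s) turns this into N = f′(2m - n)n and
-- k = f′ N(m + nω), where f′ = f or f/4 and m, n are coprime.  Primes ≡ 2 (mod 3) divide a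
-- norm only to even powers and not N(m + nω) at all, 3 ramifies, and every prime ≡ 1 (mod 3)
-- is a norm (Fermat gives a cube root of unity mod p, Thue's lemma a small solution); hence
-- f′ = 3ᵘ j² d.  Conversely, if f′ = N(g) then g·(m + nω̄), g·(m + nω) is such a basis of
-- index f′(2m - n)n.
module Submission where

open import Defs
open import Data.Nat using (ℕ)
open import Function.Bundles using (_⇔_; mk⇔)

open import Data.Nat as ℕ using (zero; suc; _≤_; _<_; z≤n; s≤s; _∸_; _%_; _!)
import Data.Nat.Properties as ℕP
open import Data.Nat.Properties using (_!*_!≢0)
open import Data.Nat.Combinatorics using (_C_; nCk≡n!/k![n-k]!; nCn≡1; k![n∸k]!∣n!)
open import Data.Nat.DivMod using (m/n*n≡m; m≡m%n+[m/n]*n; m%n<n)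
import Data.Nat.Divisibility as ℕD
open import Data.Nat.Coprimality as Cop using (Coprime; coprime⇒gcd≡1; coprime-divisor; coprime-/gcd)
open import Data.Nat.GCD using (gcd; gcd-greatest; gcd[m,n]∣m; gcd[m,n]∣n; gcd[m,n]≢0)
open import Data.Nat.Induction using (<-rec)
open import Data.Nat.ListAction using (product)
open import Data.Nat.ListAction.Properties using (product-↭)
open import Data.Nat.Primality
  using (Prime; prime?; prime[2]; euclidsLemma; prime⇒irreducible; prime⇒nonZero; ¬prime[0]; ¬prime[1]; productOfPrimes≥1)
open import Data.Nat.Primality.Factorisation using (factorise)
open import Data.Fin as Fin using (Fin; toℕ; inject₁; fromℕ; fromℕ<; remQuot; combine)
open import Data.Fin.Properties as FinP using (toℕ-inject₁; toℕ<n; toℕ-fromℕ; ¬∀⟶∃¬)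
open import Data.Integer as ℤ using (ℤ; +_; -[1+_]; _+_; _-_; _*_; -_; _^_; +≤+)
import Data.Integer.Properties as ℤP
open import Data.Integer.DivMod using (_%ℕ_; _/ℕ_; n%ℕd<d; a≡a%ℕn+[a/ℕn]*n)
open import Data.Integer.Divisibility.Signed
  using (_∣_; _∣?_; divides; ∣-refl; ∣m∣n⇒∣m+n; ∣m∣n⇒∣m-n; ∣m⇒∣-m; ∣n⇒∣m*n; ∣m⇒∣m*n; ∣ᵤ⇒∣; ∣⇒∣ᵤ)
open import Data.List using (List; []; _∷_; _++_; length)
open import Data.List.Membership.DecPropositional ℕ._≟_ using (_∈?_)
open import Data.List.Membership.Propositional.Properties using (∈-∃++)
open import Data.List.Relation.Unary.All as All using (All; []; _∷_)
open import Data.List.Relation.Unary.All.Properties using (++⁺; ++⁻ˡ; ++⁻ʳ; ¬Any⇒All¬)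
open import Data.List.Relation.Unary.AllPairs as AllPairs using (_∷_)
open import Data.List.Relation.Unary.Unique.Propositional using (Unique)
open import Data.List.Relation.Binary.Permutation.Propositional.Properties using (shift)
open import Data.Product using (∃; ∃₂; _,_; _×_; proj₁; proj₂)
open import Data.Sum using (_⊎_; inj₁; inj₂; [_,_]′)
open import Data.Unit using (tt)
open import Data.Vec.Functional using (Vector; init; tail; last)
open import Function using (id; _∘_)
open import Relation.Binary.PropositionalEquality
open import Relation.Nullary using (¬_; yes; no; contradiction)
open import Relation.Nullary.Decidable using (toWitness)
open import Algebra.Definitions.RawSemiring ℕ.+-*-rawSemiring using () renaming (_^_ to _^ˢ_; _×_ to _×ˢ_)
import Algebra.Properties.CommutativeSemiring.Binomial ℕP.+-*-commutativeSemiring as Binomial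
open import Algebra.Properties.Monoid.Sum ℕP.+-0-monoid using (sum; sum-init-last; sum-cong-≗)
import Data.Integer.Tactic.RingSolver as ℤ-Solver
import Data.Nat.Tactic.RingSolver as ℕ-Solver

∣-respʳ : ∀ {m x y} → x ≡ y → m ∣ x → m ∣ y
∣-respʳ refl m∣x = m∣x

infix 4 _≡_mod_
record _≡_mod_ (x y m : ℤ) : Set where
  constructor mk≡mod
  field divides-diff : m ∣ x - y
open _≡_mod_ public

module _ {m : ℤ} where

  ≡-mod-refl : ∀ {x} → x ≡ x mod m
  ≡-mod-refl {x} = mk≡mod (∣-respʳ (sym (ℤP.+-inverseʳ x)) (divides ℤ.0ℤ (sym (ℤP.*-zeroˡ m))))

  ≡⇒≡-mod : ∀ {x y} → x ≡ y → x ≡ y mod m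
  ≡⇒≡-mod refl = ≡-mod-refl

  ≡-mod-sym : ∀ {x y} → x ≡ y mod m → y ≡ x mod m
  ≡-mod-sym {x} {y} (mk≡mod m∣x-y) = mk≡mod (∣-respʳ (identity x y) (∣m⇒∣-m m∣x-y))
    where
    identity : ∀ x y → - (x - y) ≡ y - x
    identity = ℤ-Solver.solve-∀

  ≡-mod-trans : ∀ {x y z} → x ≡ y mod m → y ≡ z mod m → x ≡ z mod m
  ≡-mod-trans {x} {y} {z} (mk≡mod m∣x-y) (mk≡mod m∣y-z) = mk≡mod (∣-respʳ (identity x y z) (∣m∣n⇒∣m+n m∣x-y m∣y-z))
    where
    identity : ∀ x y z → (x - y) + (y - z) ≡ x - z
    identity = ℤ-Solver.solve-∀

  ≡-mod-*ʳ : ∀ {x y} z → x ≡ y mod m → x * z ≡ y * z mod m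
  ≡-mod-*ʳ {x} {y} z (mk≡mod m∣x-y) = mk≡mod (∣-respʳ (identity x y z) (∣m⇒∣m*n z m∣x-y))
    where
    identity : ∀ x y z → (x - y) * z ≡ x * z - y * z
    identity = ℤ-Solver.solve-∀

  ≡-mod-*ˡ : ∀ {x y} z → x ≡ y mod m → z * x ≡ z * y mod m
  ≡-mod-*ˡ {x} {y} z (mk≡mod m∣x-y) = mk≡mod (∣-respʳ (identity x y z) (∣n⇒∣m*n z m∣x-y))
    where
    identity : ∀ x y z → z * (x - y) ≡ z * x - z * y
    identity = ℤ-Solver.solve-∀

  ≡-mod-* : ∀ {x y u v} → x ≡ y mod m → u ≡ v mod m → x * u ≡ y * v mod m
  ≡-mod-* {y = y} {u} x≡y u≡v = ≡-mod-trans (≡-mod-*ʳ u x≡y) (≡-mod-*ˡ y u≡v)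

  ≡-mod-^ : ∀ {x y} n → x ≡ y mod m → x ^ n ≡ y ^ n mod m
  ≡-mod-^ zero    x≡y = ≡-mod-refl
  ≡-mod-^ (suc n) x≡y = ≡-mod-* x≡y (≡-mod-^ n x≡y)

prime≥2 : ∀ {p} → Prime p → 2 ≤ p
prime≥2 {0}           pr = contradiction pr ¬prime[0]
prime≥2 {1}           pr = contradiction pr ¬prime[1]
prime≥2 {suc (suc _)} _  = s≤s (s≤s z≤n)

prime∤! : ∀ {p} → Prime p → ∀ {m} → m < p → ¬ p ℕD.∣ m !
prime∤! pr {zero}  _   p∣1 = ¬prime[1] (subst Prime (ℕD.∣1⇒≡1 p∣1) pr)
prime∤! pr {suc m} m<p p∣m! with euclidsLemma (suc m) (m !) pr p∣m!
... | inj₁ p∣m = ℕP.<⇒≱ m<p (ℕD.∣⇒≤ p∣m)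
... | inj₂ p∣m! = prime∤! pr (ℕP.<-trans (ℕP.n<1+n m) m<p) p∣m!

prime∣C : ∀ {p k} → Prime p → 0 < k → k < p → p ℕD.∣ p C k
prime∣C {p@(suc q)} {k} pr 0<k k<p with euclidsLemma (p C k) (k ! ℕ.* (p ∸ k) !) pr p∣C*k![p-k]!
  where
  instance _ = k !* (p ∸ k) !≢0
  C*k![p-k]!≡p! : (p C k) ℕ.* (k ! ℕ.* (p ∸ k) !) ≡ p !
  C*k![p-k]!≡p! = trans (cong (ℕ._* (k ! ℕ.* (p ∸ k) !)) (nCk≡n!/k![n-k]! {p} {k} (ℕP.<⇒≤ k<p))) (m/n*n≡m (k![n∸k]!∣n! (ℕP.<⇒≤ k<p)))
  p∣C*k![p-k]! : p ℕD.∣ (p C k) ℕ.* (k ! ℕ.* (p ∸ k) !)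
  p∣C*k![p-k]! = subst (p ℕD.∣_) (sym C*k![p-k]!≡p!) (ℕD.m∣m*n (q !))
... | inj₁ p∣C = p∣C
... | inj₂ p∣k![p-k]! with euclidsLemma (k !) ((p ∸ k) !) pr p∣k![p-k]!
...   | inj₁ p∣k! = contradiction p∣k! (prime∤! pr k<p)
...   | inj₂ p∣[p-k]! = contradiction p∣[p-k]! (prime∤! pr (ℕP.∸-monoʳ-< 0<k (ℕP.<⇒≤ k<p)))

∣-sum : ∀ {d n} (f : Vector ℕ n) → (∀ i → d ℕD.∣ f i) → d ℕD.∣ sum f
∣-sum {n = zero}  f d∣f = _ ℕD.∣0
∣-sum {n = suc n} f d∣f = ℕD.∣m∣n⇒∣m+n (d∣f Fin.zero) (∣-sum (f ∘ Fin.suc) (d∣f ∘ Fin.suc))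

^ˢ≡^ : ∀ a n → a ^ˢ n ≡ a ℕ.^ n
^ˢ≡^ a zero    = refl
^ˢ≡^ a (suc n) = cong (a ℕ.*_) (^ˢ≡^ a n)

×ˢ≡* : ∀ n a → n ×ˢ a ≡ n ℕ.* a
×ˢ≡* zero    a = refl
×ˢ≡* (suc n) a = cong (a ℕ.+_) (×ˢ≡* n a)

binomial-theorem : ∀ a n → (a ℕ.+ 1) ℕ.^ n ≡ sum {suc n} (λ k → (n C toℕ k) ℕ.* a ℕ.^ toℕ k)
binomial-theorem a n = begin
  (a ℕ.+ 1) ℕ.^ n                    ≡⟨ sym (^ˢ≡^ (a ℕ.+ 1) n) ⟩
  (a ℕ.+ 1) ^ˢ n                      ≡⟨ Binomial.theorem n a 1 ⟩
  Binomial.binomialExpansion a 1 n    ≡⟨ sum-cong-≗ {suc n} term≡ ⟩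
  sum {suc n} (λ k → (n C toℕ k) ℕ.* a ℕ.^ toℕ k) ∎
  where
  open ≡-Reasoning
  term≡ : ∀ k → Binomial.binomialTerm a 1 n k ≡ (n C toℕ k) ℕ.* a ℕ.^ toℕ k
  term≡ k = begin
    (n C toℕ k) ×ˢ (a ^ˢ toℕ k ℕ.* 1 ^ˢ (n ∸ toℕ k))  ≡⟨ ×ˢ≡* (n C toℕ k) _ ⟩
    (n C toℕ k) ℕ.* (a ^ˢ toℕ k ℕ.* 1 ^ˢ (n ∸ toℕ k)) ≡⟨ cong₂ (λ x y → (n C toℕ k) ℕ.* (x ℕ.* y)) (^ˢ≡^ a (toℕ k))
                                                            (trans (^ˢ≡^ 1 (n ∸ toℕ k)) (ℕP.^-zeroˡ (n ∸ toℕ k))) ⟩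
    (n C toℕ k) ℕ.* (a ℕ.^ toℕ k ℕ.* 1)               ≡⟨ cong ((n C toℕ k) ℕ.*_) (ℕP.*-identityʳ _) ⟩
    (n C toℕ k) ℕ.* a ℕ.^ toℕ k ∎

fermatℕ : ∀ {p} → Prime p → ∀ a → ∃ λ M → a ℕ.^ p ≡ a ℕ.+ M ℕ.* p
fermatℕ {suc (suc r)} pr zero = 0 , refl
fermatℕ {p@(suc (suc r))} pr (suc a) = M ℕ.+ K , (begin
  suc a ℕ.^ p                                         ≡⟨ cong (ℕ._^ p) (ℕP.+-comm 1 a) ⟩
  (a ℕ.+ 1) ℕ.^ p                                     ≡⟨ binomial-theorem a p ⟩
  1 ℕ.+ sum (tail term)                               ≡⟨ cong (1 ℕ.+_) (sum-init-last (tail term)) ⟩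
  1 ℕ.+ (sum (init (tail term)) ℕ.+ last (tail term)) ≡⟨ cong₂ (λ x y → 1 ℕ.+ (x ℕ.+ y)) middle≡Kp last≡aᵖ ⟩
  1 ℕ.+ (K ℕ.* p ℕ.+ a ℕ.^ p)                         ≡⟨ cong (λ x → 1 ℕ.+ (K ℕ.* p ℕ.+ x)) aᵖ≡a+Mp ⟩
  1 ℕ.+ (K ℕ.* p ℕ.+ (a ℕ.+ M ℕ.* p))                 ≡⟨ rearrange K M p a ⟩
  suc a ℕ.+ (M ℕ.+ K) ℕ.* p                           ∎)
  where
  open ≡-Reasoning
  term : Vector ℕ (suc p)
  term k = (p C toℕ k) ℕ.* a ℕ.^ toℕ k
  p∣middle : ∀ i → p ℕD.∣ init (tail term) i
  p∣middle i = ℕD.∣m⇒∣m*n (a ℕ.^ suc (toℕ (inject₁ i)))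
    (prime∣C pr (s≤s z≤n) (subst (ℕ._< p) (sym (cong suc (toℕ-inject₁ i))) (s≤s (toℕ<n i))))
  open ℕD._∣_ (∣-sum (init (tail term)) p∣middle) renaming (quotient to K; equality to middle≡Kp)
  M : ℕ
  M = proj₁ (fermatℕ pr a)
  aᵖ≡a+Mp : a ℕ.^ p ≡ a ℕ.+ M ℕ.* p
  aᵖ≡a+Mp = proj₂ (fermatℕ pr a)
  last≡aᵖ : last (tail term) ≡ a ℕ.^ p
  last≡aᵖ = begin
    (p C toℕ (fromℕ p)) ℕ.* a ℕ.^ toℕ (fromℕ p) ≡⟨ cong (λ i → (p C i) ℕ.* a ℕ.^ i) (toℕ-fromℕ p) ⟩
    (p C p) ℕ.* a ℕ.^ p                         ≡⟨ cong (ℕ._* a ℕ.^ p) (nCn≡1 p) ⟩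
    1 ℕ.* a ℕ.^ p                               ≡⟨ ℕP.*-identityˡ _ ⟩
    a ℕ.^ p                                     ∎
  rearrange : ∀ K M p a → 1 ℕ.+ (K ℕ.* p ℕ.+ (a ℕ.+ M ℕ.* p)) ≡ suc a ℕ.+ (M ℕ.+ K) ℕ.* p
  rearrange = ℕ-Solver.solve-∀

+-^ : ∀ a n → (+ a) ^ n ≡ + (a ℕ.^ n)
+-^ a zero    = refl
+-^ a (suc n) = trans (cong ((+ a) *_) (+-^ a n)) (sym (ℤP.pos-* a (a ℕ.^ n)))

fermat : ∀ {p} → Prime p → ∀ c → c ^ p ≡ c mod + p
fermat {p} pr (+ a) = mk≡mod (divides (+ M) (begin
  (+ a) ^ p - + a             ≡⟨ cong (_- + a) (trans (+-^ a p) (cong +_ aᵖ≡a+Mp)) ⟩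
  + (a ℕ.+ M ℕ.* p) - + a     ≡⟨ cong (_- + a) (trans (ℤP.pos-+ a (M ℕ.* p)) (cong (λ x → + a + x) (ℤP.pos-* M p))) ⟩
  (+ a + + M * + p) - + a     ≡⟨ cancel (+ a) (+ M * + p) ⟩
  + M * + p                   ∎))
  where
  open ≡-Reasoning
  M : ℕ
  M = proj₁ (fermatℕ pr a)
  aᵖ≡a+Mp : a ℕ.^ p ≡ a ℕ.+ M ℕ.* p
  aᵖ≡a+Mp = proj₂ (fermatℕ pr a)
  cancel : ∀ a b → (a + b) - a ≡ b
  cancel = ℤ-Solver.solve-∀
fermat {p@(suc q)} pr c@(-[1+ n ]) =
  ≡-mod-trans (≡-mod-^ p c≡[1+n]q) (≡-mod-trans (fermat pr (+ (suc n ℕ.* q))) (≡-mod-sym c≡[1+n]q))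
  where
  -- c + (1 + n) p = (1 + n) q is a non-negative representative of c
  c≡[1+n]q : c ≡ + (suc n ℕ.* q) mod + p
  c≡[1+n]q = mk≡mod (divides (- + suc n) (trans (cong (λ x → c - x) (ℤP.pos-* (suc n) q)) (identity (+ suc n) (+ q))))
    where
    identity : ∀ s q → - s - s * q ≡ (- s) * (ℤ.1ℤ + q)
    identity = ℤ-Solver.solve-∀

-- ‖ (a , b) ‖² = a² - ab + b² is the norm of the Eisenstein integer a + bω
-- (ω² + ω + 1 = 0); _*V_ is their product and conj (below) their conjugation.
_*V_ : V → V → V
(a , b) *V (c , d) = (a * c - b * d , a * d + b * c - b * d)

‖*V‖² : ∀ v w → ‖ v *V w ‖² ≡ ‖ v ‖² * ‖ w ‖²
‖*V‖² (a , b) (c , d) = identity a b c d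
  where
  identity : ∀ a b c d →
    (a * c - b * d) * (a * c - b * d) - (a * c - b * d) * (a * d + b * c - b * d)
      + (a * d + b * c - b * d) * (a * d + b * c - b * d)
    ≡ (a * a - a * b + b * b) * (c * c - c * d + d * d)
  identity = ℤ-Solver.solve-∀

i*i≡∣i∣*∣i∣ : ∀ i → i * i ≡ + (ℤ.∣ i ∣ ℕ.* ℤ.∣ i ∣)
i*i≡∣i∣*∣i∣ (+ n)    = sym (ℤP.pos-* n n)
i*i≡∣i∣*∣i∣ -[1+ n ] = refl

4*‖‖² : ∀ a b → + 4 * ‖ (a , b) ‖² ≡ + (ℤ.∣ + 2 * a - b ∣ ℕ.* ℤ.∣ + 2 * a - b ∣ ℕ.+ 3 ℕ.* (ℤ.∣ b ∣ ℕ.* ℤ.∣ b ∣))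
4*‖‖² a b = begin
  + 4 * ‖ (a , b) ‖²                                  ≡⟨ identity a b ⟩
  (+ 2 * a - b) * (+ 2 * a - b) + + 3 * (b * b)       ≡⟨ cong₂ (λ x y → x + + 3 * y) (i*i≡∣i∣*∣i∣ (+ 2 * a - b)) (i*i≡∣i∣*∣i∣ b) ⟩
  + (X ℕ.* X) + + 3 * + (Y ℕ.* Y)                     ≡⟨ cong (λ y → + (X ℕ.* X) + y) (sym (ℤP.pos-* 3 (Y ℕ.* Y))) ⟩
  + (X ℕ.* X) + + (3 ℕ.* (Y ℕ.* Y))                   ≡⟨ sym (ℤP.pos-+ (X ℕ.* X) (3 ℕ.* (Y ℕ.* Y))) ⟩
  + (X ℕ.* X ℕ.+ 3 ℕ.* (Y ℕ.* Y))                     ∎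
  where
  open ≡-Reasoning
  X : ℕ
  X = ℤ.∣ + 2 * a - b ∣
  Y : ℕ
  Y = ℤ.∣ b ∣
  identity : ∀ a b → + 4 * (a * a - a * b + b * b) ≡ (+ 2 * a - b) * (+ 2 * a - b) + + 3 * (b * b)
  identity = ℤ-Solver.solve-∀

norm : V → ℕ
norm v = ℤ.∣ ‖ v ‖² ∣

‖‖²≡norm : ∀ v → ‖ v ‖² ≡ + norm v
‖‖²≡norm (a , b) = nonNegative (‖ (a , b) ‖²) (4*‖‖² a b)
  where
  nonNegative : ∀ x {n} → + 4 * x ≡ + n → x ≡ + ℤ.∣ x ∣
  nonNegative (+ _) _ = refl

‖‖²≡0⇒≡0V : ∀ v → ‖ v ‖² ≡ + 0 → v ≡ 0V
‖‖²≡0⇒≡0V (a , b) ‖v‖²≡0 = cong₂ _,_ a≡0 b≡0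
  where
  squares≡0 : ∀ X Y → X ℕ.* X ℕ.+ 3 ℕ.* (Y ℕ.* Y) ≡ 0 → X ≡ 0 × Y ≡ 0
  squares≡0 zero zero    _ = refl , refl
  squares≡0 zero (suc Y) ()
  squares≡0 (suc X) _    ()
  X,Y≡0 : ℤ.∣ + 2 * a - b ∣ ≡ 0 × ℤ.∣ b ∣ ≡ 0
  X,Y≡0 = squares≡0 ℤ.∣ + 2 * a - b ∣ ℤ.∣ b ∣
            (ℤP.+-injective (trans (sym (4*‖‖² a b)) (trans (cong (+ 4 *_) ‖v‖²≡0) (ℤP.*-zeroʳ (+ 4)))))
  b≡0 : b ≡ + 0
  b≡0 = ℤP.∣i∣≡0⇒i≡0 (proj₂ X,Y≡0)
  2a≡0 : + 2 * a ≡ + 0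
  2a≡0 = begin
    + 2 * a           ≡⟨ sym (ℤP.+-identityʳ (+ 2 * a)) ⟩
    + 2 * a + + 0     ≡⟨ cong (λ x → + 2 * a + - x) (sym b≡0) ⟩
    + 2 * a - b       ≡⟨ ℤP.∣i∣≡0⇒i≡0 (proj₁ X,Y≡0) ⟩
    + 0               ∎
    where open ≡-Reasoning
  a≡0 : a ≡ + 0
  a≡0 with ℤP.i*j≡0⇒i≡0∨j≡0 (+ 2) 2a≡0
  ... | inj₂ a≡0 = a≡0

norm≤ : ∀ a b → norm (a , b) ≤ ℤ.∣ a ∣ ℕ.* ℤ.∣ a ∣ ℕ.+ ℤ.∣ a ∣ ℕ.* ℤ.∣ b ∣ ℕ.+ ℤ.∣ b ∣ ℕ.* ℤ.∣ b ∣
norm≤ a b = subst (norm (a , b) ≤_) (sym bound≡norm+m) (ℕP.m≤m+n (norm (a , b)) m)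
  where
  i+∣i∣≡+ : ∀ i → ∃ λ m → i + + ℤ.∣ i ∣ ≡ + m
  i+∣i∣≡+ (+ n)    = n ℕ.+ n , sym (ℤP.pos-+ n n)
  i+∣i∣≡+ -[1+ n ] = 0 , ℤP.+-inverseˡ (+ suc n)
  m : ℕ
  m = proj₁ (i+∣i∣≡+ (a * b))
  α : ℕ
  α = ℤ.∣ a ∣
  β : ℕ
  β = ℤ.∣ b ∣
  identity : ∀ a b W → a * a + W + b * b ≡ (a * a - a * b + b * b) + (a * b + W)
  identity = ℤ-Solver.solve-∀
  bound≡norm+m : α ℕ.* α ℕ.+ α ℕ.* β ℕ.+ β ℕ.* β ≡ norm (a , b) ℕ.+ m
  bound≡norm+m = ℤP.+-injective (begin
    + (α ℕ.* α ℕ.+ α ℕ.* β ℕ.+ β ℕ.* β)      ≡⟨ trans (ℤP.pos-+ (α ℕ.* α ℕ.+ α ℕ.* β) (β ℕ.* β))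
                                                    (cong (_+ + (β ℕ.* β)) (ℤP.pos-+ (α ℕ.* α) (α ℕ.* β))) ⟩
    + (α ℕ.* α) + + (α ℕ.* β) + + (β ℕ.* β)  ≡⟨ cong₂ _+_ (cong₂ _+_ (sym (i*i≡∣i∣*∣i∣ a)) (cong +_ (sym (ℤP.abs-* a b))))
                                                    (sym (i*i≡∣i∣*∣i∣ b)) ⟩
    a * a + + ℤ.∣ a * b ∣ + b * b              ≡⟨ identity a b (+ ℤ.∣ a * b ∣) ⟩
    ‖ (a , b) ‖² + (a * b + + ℤ.∣ a * b ∣)     ≡⟨ cong₂ _+_ (‖‖²≡norm (a , b)) (proj₂ (i+∣i∣≡+ (a * b))) ⟩
    + norm (a , b) + + m                     ≡⟨ sym (ℤP.pos-+ (norm (a , b)) m) ⟩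
    + (norm (a , b) ℕ.+ m)                   ∎)
    where open ≡-Reasoning

_-V_ : V → V → V
(a , b) -V (c , d) = (a - c , b - d)

conj : V → V
conj (a , b) = (a - b , - b)

‖conj‖² : ∀ v → ‖ conj v ‖² ≡ ‖ v ‖²
‖conj‖² (a , b) = identity a b
  where
  identity : ∀ a b → (a - b) * (a - b) - (a - b) * (- b) + (- b) * (- b) ≡ a * a - a * b + b * b
  identity = ℤ-Solver.solve-∀

*V-distrib-+V : ∀ g u v → (g *V u) +V (g *V v) ≡ g *V (u +V v)
*V-distrib-+V (g₁ , g₂) (a , b) (c , d) = cong₂ _,_ (identity₁ g₁ g₂ a b c d) (identity₂ g₁ g₂ a b c d)
  where
  identity₁ : ∀ g₁ g₂ a b c d → (g₁ * a - g₂ * b) + (g₁ * c - g₂ * d) ≡ g₁ * (a + c) - g₂ * (b + d)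
  identity₁ = ℤ-Solver.solve-∀
  identity₂ : ∀ g₁ g₂ a b c d → (g₁ * b + g₂ * a - g₂ * b) + (g₁ * d + g₂ * c - g₂ * d)
                                ≡ g₁ * (b + d) + g₂ * (a + c) - g₂ * (b + d)
  identity₂ = ℤ-Solver.solve-∀

*V-distrib--V : ∀ g u v → (g *V u) -V (g *V v) ≡ g *V (u -V v)
*V-distrib--V (g₁ , g₂) (a , b) (c , d) = cong₂ _,_ (identity₁ g₁ g₂ a b c d) (identity₂ g₁ g₂ a b c d)
  where
  identity₁ : ∀ g₁ g₂ a b c d → (g₁ * a - g₂ * b) - (g₁ * c - g₂ * d) ≡ g₁ * (a - c) - g₂ * (b - d)
  identity₁ = ℤ-Solver.solve-∀
  identity₂ : ∀ g₁ g₂ a b c d → (g₁ * b + g₂ * a - g₂ * b) - (g₁ * d + g₂ * c - g₂ * d)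
                                ≡ g₁ * (b - d) + g₂ * (a - c) - g₂ * (b - d)
  identity₂ = ℤ-Solver.solve-∀

det-*V : ∀ g u v → det (g *V u) (g *V v) ≡ ‖ g ‖² * det u v
det-*V (g₁ , g₂) (a , b) (c , d) = identity g₁ g₂ a b c d
  where
  identity : ∀ g₁ g₂ a b c d →
    (g₁ * a - g₂ * b) * (g₁ * d + g₂ * c - g₂ * d) - (g₁ * b + g₂ * a - g₂ * b) * (g₁ * c - g₂ * d)
    ≡ (g₁ * g₁ - g₁ * g₂ + g₂ * g₂) * (a * d - b * c)
  identity = ℤ-Solver.solve-∀

‖·V‖² : ∀ s v → ‖ s ·V v ‖² ≡ s * s * ‖ v ‖²
‖·V‖² s (a , b) = identity s a b
  where
  identity : ∀ s a b → (s * a) * (s * a) - (s * a) * (s * b) + (s * b) * (s * b) ≡ s * s * (a * a - a * b + b * b)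
  identity = ℤ-Solver.solve-∀

IsNorm : ℕ → Set
IsNorm n = ∃ λ v → ‖ v ‖² ≡ + n

IsNorm-* : ∀ {m n} → IsNorm m → IsNorm n → IsNorm (m ℕ.* n)
IsNorm-* {m} {n} (v , ‖v‖²≡m) (w , ‖w‖²≡n) =
  v *V w , trans (‖*V‖² v w) (trans (cong₂ _*_ ‖v‖²≡m ‖w‖²≡n) (sym (ℤP.pos-* m n)))

IsNorm-1 : IsNorm 1
IsNorm-1 = (+ 1 , + 0) , refl

IsNorm-3 : IsNorm 3
IsNorm-3 = (+ 2 , + 1) , refl

IsNorm-square : ∀ j → IsNorm (j ℕ.* j)
IsNorm-square j = (+ j , + 0) , trans (identity (+ j)) (sym (ℤP.pos-* j j))
  where
  identity : ∀ j → j * j - j * + 0 + + 0 * + 0 ≡ j * j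
  identity = ℤ-Solver.solve-∀

prime[3] : Prime 3
prime[3] = toWitness {a? = prime? 3} tt

euclidℤ : ∀ {p} → Prime p → ∀ a b → + p ∣ a * b → + p ∣ a ⊎ + p ∣ b
euclidℤ {p} pr a b p∣ab with euclidsLemma ℤ.∣ a ∣ ℤ.∣ b ∣ pr (subst (p ℕD.∣_) (ℤP.abs-* a b) (∣⇒∣ᵤ p∣ab))
... | inj₁ p∣a = inj₁ (∣ᵤ⇒∣ p∣a)
... | inj₂ p∣b = inj₂ (∣ᵤ⇒∣ p∣b)

prime∣square : ∀ {p} → Prime p → ∀ x → + p ∣ x * x → + p ∣ x
prime∣square pr x p∣x² with euclidℤ pr x x p∣x²
... | inj₁ p∣x = p∣x
... | inj₂ p∣x = p∣x

prime∣cube : ∀ {p} → Prime p → ∀ x → + p ∣ x * x * x → + p ∣ x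
prime∣cube pr x p∣x³ with euclidℤ pr (x * x) x p∣x³
... | inj₁ p∣x² = prime∣square pr x p∣x²
... | inj₂ p∣x  = p∣x

∣-resp-≡mod : ∀ {m x y} → x ≡ y mod m → m ∣ x → m ∣ y
∣-resp-≡mod {x = x} {y} (mk≡mod m∣x-y) m∣x = ∣-respʳ (lemma x y) (∣m∣n⇒∣m-n m∣x m∣x-y)
  where
  lemma : ∀ x y → x - (x - y) ≡ y
  lemma = ℤ-Solver.solve-∀

^-split : ∀ {p} e → p ≡ 2 ℕ.+ 3 ℕ.* e → ∀ z → z ^ p ≡ z * z * (z * z * z) ^ e
^-split e refl z = begin
  z ^ (2 ℕ.+ 3 ℕ.* e)            ≡⟨ ℤP.^-distribˡ-+-* z 2 (3 ℕ.* e) ⟩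
  z ^ 2 * z ^ (3 ℕ.* e)          ≡⟨ cong₂ _*_ (square z) (sym (ℤP.^-*-assoc z 3 e)) ⟩
  z * z * (z ^ 3) ^ e            ≡⟨ cong (λ c → z * z * c ^ e) (cube z) ⟩
  z * z * (z * z * z) ^ e        ∎
  where
  open ≡-Reasoning
  square : ∀ z → z * (z * ℤ.1ℤ) ≡ z * z
  square = ℤ-Solver.solve-∀
  cube : ∀ z → z * (z * (z * ℤ.1ℤ)) ≡ z * z * z
  cube = ℤ-Solver.solve-∀

cube-congruence⇒∣ : ∀ {p} → Prime p → p % 3 ≡ 2 → ∀ x y → x * x * x ≡ y * y * y mod + p → + p ∣ x * y * (y - x)
cube-congruence⇒∣ {p} pr p%3≡2 x y x³≡y³ = ∣-respʳ (factor x y) (divides-diff xy²≡yx²)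
  where
  e : ℕ
  e = p ℕ./ 3
  p≡2+3e : p ≡ 2 ℕ.+ 3 ℕ.* e
  p≡2+3e = trans (m≡m%n+[m/n]*n p 3) (cong₂ ℕ._+_ p%3≡2 (ℕP.*-comm e 3))
  T : ℤ
  T = (x * x * x) ^ e
  x≡x²T : x ≡ x * x * T mod + p
  x≡x²T = ≡-mod-trans (≡-mod-sym (fermat pr x)) (≡⇒≡-mod (^-split e p≡2+3e x))
  y≡y²T : y ≡ y * y * T mod + p
  y≡y²T = ≡-mod-trans (≡-mod-sym (fermat pr y))
            (≡-mod-trans (≡⇒≡-mod (^-split e p≡2+3e y)) (≡-mod-*ˡ (y * y) (≡-mod-^ e (≡-mod-sym x³≡y³))))
  xy²≡yx² : x * (y * y) ≡ y * (x * x) mod + p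
  xy²≡yx² = ≡-mod-trans (≡-mod-*ʳ (y * y) x≡x²T)
              (≡-mod-trans (≡⇒≡-mod (swap x y T)) (≡-mod-sym (≡-mod-*ʳ (x * x) y≡y²T)))
    where
    swap : ∀ x y T → x * x * T * (y * y) ≡ y * y * T * (x * x)
    swap = ℤ-Solver.solve-∀
  factor : ∀ x y → x * (y * y) - y * (x * x) ≡ x * y * (y - x)
  factor = ℤ-Solver.solve-∀

cube-injective : ∀ {p} → Prime p → p % 3 ≡ 2 → ∀ x y → x * x * x ≡ y * y * y mod + p → x ≡ y mod + p
cube-injective {p} pr p%3≡2 x y x³≡y³ =
  [ both-divisible , ≡-mod-sym ∘ mk≡mod ]′ (euclidℤ pr (x * y) (y - x) (cube-congruence⇒∣ pr p%3≡2 x y x³≡y³))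
  where
  p∣x⇒p∣y : + p ∣ x → + p ∣ y
  p∣x⇒p∣y p∣x = prime∣cube pr y (∣-resp-≡mod x³≡y³ (∣m⇒∣m*n x (∣m⇒∣m*n x p∣x)))
  p∣y⇒p∣x : + p ∣ y → + p ∣ x
  p∣y⇒p∣x p∣y = prime∣cube pr x (∣-resp-≡mod (≡-mod-sym x³≡y³) (∣m⇒∣m*n y (∣m⇒∣m*n y p∣y)))
  both-divisible : + p ∣ x * y → x ≡ y mod + p
  both-divisible p∣xy = mk≡mod
    ([ (λ p∣x → ∣m∣n⇒∣m-n p∣x (p∣x⇒p∣y p∣x)) , (λ p∣y → ∣m∣n⇒∣m-n (p∣y⇒p∣x p∣y) p∣y) ]′ (euclidℤ pr x y p∣xy))

prime∣3⇒≡3 : ∀ {p} → Prime p → + p ∣ + 3 → p ≡ 3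
prime∣3⇒≡3 pr p∣3 with prime⇒irreducible prime[3] (∣⇒∣ᵤ p∣3)
... | inj₁ refl = contradiction pr ¬prime[1]
... | inj₂ p≡3 = p≡3

prime≡2∣‖‖² : ∀ {p} → Prime p → p % 3 ≡ 2 → ∀ a b → + p ∣ ‖ (a , b) ‖² → + p ∣ a × + p ∣ b
prime≡2∣‖‖² {p} pr p%3≡2 a b p∣N = p∣a , ∣-respʳ (cancel a b) (∣m∣n⇒∣m-n p∣a+b p∣a)
  where
  -a≡b : - a ≡ b mod + p
  -a≡b = cube-injective pr p%3≡2 (- a) b (mk≡mod (∣-respʳ (sym (sum-of-cubes a b)) (∣n⇒∣m*n (- (a + b)) p∣N)))
    where
    sum-of-cubes : ∀ a b → (- a) * (- a) * (- a) - b * b * b ≡ - (a + b) * (a * a - a * b + b * b)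
    sum-of-cubes = ℤ-Solver.solve-∀
  p∣a+b : + p ∣ a + b
  p∣a+b = ∣-respʳ (negate a b) (∣m⇒∣-m (divides-diff -a≡b))
    where
    negate : ∀ a b → - (- a - b) ≡ a + b
    negate = ℤ-Solver.solve-∀
  p∣3a² : + p ∣ + 3 * (a * a)
  p∣3a² = ∣-respʳ (identity a b) (∣m∣n⇒∣m+n p∣N (∣m⇒∣m*n (+ 2 * a - b) p∣a+b))
    where
    identity : ∀ a b → (a * a - a * b + b * b) + (a + b) * (+ 2 * a - b) ≡ + 3 * (a * a)
    identity = ℤ-Solver.solve-∀
  p∣a : + p ∣ a
  p∣a = [ (λ p∣3 → contradiction (trans (cong (_% 3) (sym (prime∣3⇒≡3 pr p∣3))) p%3≡2) λ ()) , prime∣square pr a ]′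
          (euclidℤ pr (+ 3) (a * a) p∣3a²)
  cancel : ∀ a b → a + b - a ≡ b
  cancel = ℤ-Solver.solve-∀

prime∤pos : ∀ {p n} → 0 < n → n < p → ¬ (+ p ∣ + n)
prime∤pos {n = suc _} _ n<p p∣n = ℕP.<⇒≱ n<p (ℕD.∣⇒≤ (∣⇒∣ᵤ p∣n))

Poly : Set
Poly = List ℤ

eval : Poly → ℤ → ℤ
eval []      x = ℤ.0ℤ
eval (c ∷ P) x = c + x * eval P x

-- The quotient of c + X P by X - r, whatever the constant term c.
quotient : ℤ → Poly → Poly
quotient r []      = []
quotient r (c ∷ P) = eval (c ∷ P) r ∷ quotient r P

length-quotient : ∀ r P → length (quotient r P) ≡ length P
length-quotient r []      = refl
length-quotient r (c ∷ P) = cong suc (length-quotient r P)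

eval-quotient : ∀ c P x r → eval (c ∷ P) x - eval (c ∷ P) r ≡ (x - r) * eval (quotient r P) x
eval-quotient c []       x r = identity c x r
  where
  identity : ∀ c x r → c + x * ℤ.0ℤ - (c + r * ℤ.0ℤ) ≡ (x - r) * ℤ.0ℤ
  identity = ℤ-Solver.solve-∀
eval-quotient c (d ∷ P) x r = begin
  (c + x * Px) - (c + r * Pr)      ≡⟨ regroup c x r Px Pr ⟩
  x * (Px - Pr) + (x - r) * Pr     ≡⟨ cong (λ y → x * y + (x - r) * Pr) (eval-quotient d P x r) ⟩
  x * ((x - r) * Qx) + (x - r) * Pr ≡⟨ factor x r Qx Pr ⟩
  (x - r) * (Pr + x * Qx)          ∎
  where
  open ≡-Reasoning
  Px : ℤ
  Px = eval (d ∷ P) x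
  Pr : ℤ
  Pr = eval (d ∷ P) r
  Qx : ℤ
  Qx = eval (quotient r P) x
  regroup : ∀ c x r Px Pr → (c + x * Px) - (c + r * Pr) ≡ x * (Px - Pr) + (x - r) * Pr
  regroup = ℤ-Solver.solve-∀
  factor : ∀ x r Qx Pr → x * ((x - r) * Qx) + (x - r) * Pr ≡ (x - r) * (Pr + x * Qx)
  factor = ℤ-Solver.solve-∀

∣-coefficients : ∀ {m} r c P → m ∣ eval (c ∷ P) r → All (m ∣_) (quotient r P) → All (m ∣_) (c ∷ P)
∣-coefficients r c []      m∣c+r0 [] = ∣-respʳ (identity c r) m∣c+r0 ∷ []
  where
  identity : ∀ c r → c + r * ℤ.0ℤ ≡ c
  identity = ℤ-Solver.solve-∀
∣-coefficients r c (d ∷ P) m∣eval (m∣evalP ∷ m∣quot) =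
  ∣-respʳ (identity c r (eval (d ∷ P) r)) (∣m∣n⇒∣m-n m∣eval (∣n⇒∣m*n r m∣evalP)) ∷ ∣-coefficients r d P m∣evalP m∣quot
  where
  identity : ∀ c r E → c + r * E - r * E ≡ c
  identity = ℤ-Solver.solve-∀

lagrange : ∀ {p} → Prime p → ∀ L P → length P ≡ L → L ≤ p →
           (∀ (i : Fin L) → + p ∣ eval P (+ suc (toℕ i))) → All (+ p ∣_) P
lagrange pr zero    []      _   _   _     = []
lagrange {p} pr (suc L) (c ∷ P) len L<p roots =
  ∣-coefficients r c P p∣P[r] (lagrange pr L (quotient r P) (trans (length-quotient r P) (ℕP.suc-injective len)) (ℕP.<⇒≤ L<p) quotient-roots)
  where
  r : ℤ
  r = + suc L
  p∣P[r] : + p ∣ eval (c ∷ P) r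
  p∣P[r] = subst (λ n → + p ∣ eval (c ∷ P) (+ suc n)) (toℕ-fromℕ L) (roots (fromℕ L))
  quotient-roots : ∀ (i : Fin L) → + p ∣ eval (quotient r P) (+ suc (toℕ i))
  quotient-roots i = [ (λ p∣x-r → contradiction (∣-respʳ (x-r≡-[L-i]) p∣x-r) p∤-[L-i]) , id ]′
                       (euclidℤ pr (x - r) (eval (quotient r P) x)
                         (∣-respʳ (eval-quotient c P x r) (∣m∣n⇒∣m-n p∣P[x] p∣P[r])))
    where
    x : ℤ
    x = + suc (toℕ i)
    p∣P[x] : + p ∣ eval (c ∷ P) x
    p∣P[x] = subst (λ n → + p ∣ eval (c ∷ P) (+ suc n)) (toℕ-inject₁ i) (roots (inject₁ i))
    x-r≡-[L-i] : x - r ≡ - (+ (L ∸ toℕ i))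
    x-r≡-[L-i] = trans (ℤP.[+m]-[+n]≡m⊖n (suc (toℕ i)) (suc L)) (ℤP.⊖-≤ (ℕP.<⇒≤ (s≤s (toℕ<n i))))
    p∤-[L-i] : ¬ (+ p ∣ - (+ (L ∸ toℕ i)))
    p∤-[L-i] p∣ = prime∤pos (ℕP.m<n⇒0<n∸m (toℕ<n i)) (ℕP.≤-<-trans (ℕP.m∸n≤m L (toℕ i)) L<p)
                    (∣-respʳ (ℤP.neg-involutive _) (∣m⇒∣-m p∣))

monomial : ℕ → Poly
monomial zero    = ℤ.1ℤ ∷ []
monomial (suc k) = ℤ.0ℤ ∷ monomial k

length-monomial : ∀ k → length (monomial k) ≡ suc k
length-monomial zero    = refl
length-monomial (suc k) = cong suc (length-monomial k)

eval-monomial : ∀ k x → eval (monomial k) x ≡ x ^ k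
eval-monomial zero    x = cong (λ y → ℤ.1ℤ + y) (ℤP.*-zeroʳ x)
eval-monomial (suc k) x = trans (ℤP.+-identityˡ _) (cong (x *_) (eval-monomial k x))

cube-root-of-non-root : ∀ {p} e → Prime p → p ≡ suc (3 ℕ.* e) → ∀ a → ¬ (+ p ∣ a) → ¬ (+ p ∣ a ^ e - ℤ.1ℤ) →
                        + p ∣ a ^ e * a ^ e + a ^ e + ℤ.1ℤ
cube-root-of-non-root {p} e pr p≡1+3e a p∤a p∤t-1 =
  [ (λ p∣t-1 → contradiction p∣t-1 p∤t-1) , id ]′ (euclidℤ pr (t - ℤ.1ℤ) (t * t + t + ℤ.1ℤ) p∣t³-1)
  where
  t : ℤ
  t = a ^ e
  p∣a[a³ᵉ-1] : + p ∣ a * (a ^ (3 ℕ.* e) - ℤ.1ℤ)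
  p∣a[a³ᵉ-1] = ∣-respʳ (trans (cong (λ n → a ^ n - a) p≡1+3e) (factor a (a ^ (3 ℕ.* e)))) (divides-diff (fermat pr a))
    where
    factor : ∀ a X → a * X - a ≡ a * (X - ℤ.1ℤ)
    factor = ℤ-Solver.solve-∀
  p∣t³-1 : + p ∣ (t - ℤ.1ℤ) * (t * t + t + ℤ.1ℤ)
  p∣t³-1 = ∣-respʳ (trans (cong (_- ℤ.1ℤ) a³ᵉ≡t³) (factor t))
             ([ (λ p∣a → contradiction p∣a p∤a) , id ]′ (euclidℤ pr a _ p∣a[a³ᵉ-1]))
    where
    a³ᵉ≡t³ : a ^ (3 ℕ.* e) ≡ t * t * t
    a³ᵉ≡t³ = trans (cong (a ^_) (ℕP.*-comm 3 e)) (trans (sym (ℤP.^-*-assoc a e 3)) (cube t))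
      where
      cube : ∀ t → t * (t * (t * ℤ.1ℤ)) ≡ t * t * t
      cube = ℤ-Solver.solve-∀
    factor : ∀ t → t * t * t - ℤ.1ℤ ≡ (t - ℤ.1ℤ) * (t * t + t + ℤ.1ℤ)
    factor = ℤ-Solver.solve-∀

cube-root-of-unity : ∀ {p} → Prime p → p % 3 ≡ 1 → ∃ λ t → + p ∣ t * t + t + ℤ.1ℤ
cube-root-of-unity {p} pr p%3≡1 = root-for (p ℕ./ 3) (trans (m≡m%n+[m/n]*n p 3) (cong₂ ℕ._+_ p%3≡1 (ℕP.*-comm (p ℕ./ 3) 3)))
  where
  root-for : ∀ e → p ≡ suc (3 ℕ.* e) → ∃ λ t → + p ∣ t * t + t + ℤ.1ℤ
  root-for zero    refl     = contradiction pr ¬prime[1]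
  root-for e@(suc k) p≡1+3e = a ^ e , cube-root-of-non-root e pr p≡1+3e a p∤a (proj₂ non-root)
    where
    IsRoot : Fin (suc e) → Set
    IsRoot i = + p ∣ (+ suc (toℕ i)) ^ e - ℤ.1ℤ
    1+e<p : suc e < p
    1+e<p = subst (suc e <_) (sym p≡1+3e) (s≤s (ℕP.m<m+n e (s≤s z≤n)))
    Xᵉ-1 : Poly
    Xᵉ-1 = ℤ.-1ℤ ∷ monomial k
    eval-Xᵉ-1 : ∀ x → eval Xᵉ-1 x ≡ x ^ e - ℤ.1ℤ
    eval-Xᵉ-1 x = trans (cong (λ y → ℤ.-1ℤ + x * y) (eval-monomial k x)) (ℤP.+-comm ℤ.-1ℤ (x ^ e))
    not-all-roots : ¬ (∀ i → IsRoot i)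
    not-all-roots all-roots with lagrange pr (suc e) Xᵉ-1 (cong suc (length-monomial k)) (ℕP.<⇒≤ 1+e<p)
                                   (λ i → ∣-respʳ (sym (eval-Xᵉ-1 (+ suc (toℕ i)))) (all-roots i))
    ... | p∣-1 ∷ _ = ¬prime[1] (subst Prime (ℕD.∣1⇒≡1 (∣⇒∣ᵤ p∣-1)) pr)
    non-root : ∃ λ i → ¬ IsRoot i
    non-root = ¬∀⟶∃¬ (suc e) IsRoot (λ i → + p ∣? (+ suc (toℕ i)) ^ e - ℤ.1ℤ) not-all-roots
    a : ℤ
    a = + suc (toℕ (proj₁ non-root))
    p∤a : ¬ (+ p ∣ a)
    p∤a = prime∤pos (s≤s z≤n) (ℕP.≤-<-trans (toℕ<n (proj₁ non-root)) 1+e<p)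

prime≡2∣norm : ∀ {p n} → Prime p → p % 3 ≡ 2 → IsNorm n → p ℕD.∣ n → ∃ λ M → IsNorm M × n ≡ p ℕ.* p ℕ.* M
prime≡2∣norm {p} {n} pr p%3≡2 ((a , b) , ‖v‖²≡n) p∣n = norm w , (w , ‖‖²≡norm w) , ℤP.+-injective (begin
  + n                          ≡⟨ sym ‖v‖²≡n ⟩
  ‖ (a , b) ‖²                 ≡⟨ cong ‖_‖² v≡pw ⟩
  ‖ (+ p) ·V w ‖²                ≡⟨ ‖·V‖² (+ p) w ⟩
  + p * + p * ‖ w ‖²           ≡⟨ cong₂ _*_ (sym (ℤP.pos-* p p)) (‖‖²≡norm w) ⟩
  + (p ℕ.* p) * + norm w       ≡⟨ sym (ℤP.pos-* (p ℕ.* p) (norm w)) ⟩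
  + (p ℕ.* p ℕ.* norm w)       ∎)
  where
  open ≡-Reasoning
  p∣a,b : + p ∣ a × + p ∣ b
  p∣a,b = prime≡2∣‖‖² pr p%3≡2 a b (subst (+ p ∣_) (sym ‖v‖²≡n) (∣ᵤ⇒∣ p∣n))
  w : V
  w = (_∣_.quotient (proj₁ p∣a,b) , _∣_.quotient (proj₂ p∣a,b))
  v≡pw : (a , b) ≡ (+ p) ·V w
  v≡pw = cong₂ _,_ (trans (_∣_.equality (proj₁ p∣a,b)) (ℤP.*-comm _ (+ p)))
                   (trans (_∣_.equality (proj₂ p∣a,b)) (ℤP.*-comm _ (+ p)))

⌊√_⌋ : ∀ n → ∃ λ r → r ℕ.* r ≤ n × n < suc r ℕ.* suc r
⌊√ zero  ⌋ = 0 , z≤n , s≤s z≤n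
⌊√ suc n ⌋ with ⌊√ n ⌋
... | r , r²≤n , n<[r+1]² with suc r ℕ.* suc r ℕ.≤? suc n
...   | yes [r+1]²≤1+n = suc r , [r+1]²≤1+n , ℕP.≤-trans (s≤s n<[r+1]²) (ℕP.*-mono-< (ℕP.n<1+n (suc r)) (ℕP.n<1+n (suc r)))
...   | no  [r+1]²≰1+n = r , ℕP.m≤n⇒m≤1+n r²≤n , ℕP.≰⇒> [r+1]²≰1+n

square≢prime : ∀ {p} → Prime p → ∀ r → r ℕ.* r ≢ p
square≢prime {p} pr r r²≡p with prime⇒irreducible pr (ℕD.divides r (sym r²≡p))
... | inj₁ refl = ¬prime[1] (subst Prime (sym r²≡p) pr)
... | inj₂ refl = ¬prime[1] (subst Prime (ℕP.*-cancelˡ-≡ r 1 r {{prime⇒nonZero pr}} (trans r²≡p (sym (ℕP.*-identityʳ r)))) pr)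

multiple-below-3p : ∀ {p n} → p ℕD.∣ n → n < 3 ℕ.* p → n ≡ 0 ⊎ n ≡ p ⊎ n ≡ 2 ℕ.* p
multiple-below-3p {p} (ℕD.divides 0 refl) _ = inj₁ refl
multiple-below-3p {p} (ℕD.divides 1 refl) _ = inj₂ (inj₁ (ℕP.*-identityˡ p))
multiple-below-3p {p} (ℕD.divides 2 refl) _ = inj₂ (inj₂ refl)
multiple-below-3p {p} (ℕD.divides (suc (suc (suc k))) refl) [3+k]p<3p =
  contradiction [3+k]p<3p (ℕP.≤⇒≯ (ℕP.*-monoˡ-≤ p (ℕP.m≤m+n 3 k)))

≡-%ℕ⇒∣- : ∀ p .{{_ : ℕ.NonZero p}} x y → x %ℕ p ≡ y %ℕ p → + p ∣ x - y
≡-%ℕ⇒∣- p x y x%p≡y%p = divides (x /ℕ p - y /ℕ p) (begin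
  x - y                                                         ≡⟨ cong₂ _-_ (a≡a%ℕn+[a/ℕn]*n x p) (a≡a%ℕn+[a/ℕn]*n y p) ⟩
  (+ (x %ℕ p) + x /ℕ p * + p) - (+ (y %ℕ p) + y /ℕ p * + p)     ≡⟨ cong (λ r → (+ r + x /ℕ p * + p) - (+ (y %ℕ p) + y /ℕ p * + p)) x%p≡y%p ⟩
  (+ (y %ℕ p) + x /ℕ p * + p) - (+ (y %ℕ p) + y /ℕ p * + p)     ≡⟨ cancel (+ (y %ℕ p)) (x /ℕ p) (y /ℕ p) (+ p) ⟩
  (x /ℕ p - y /ℕ p) * + p                                       ∎)
  where
  open ≡-Reasoning
  cancel : ∀ r q q′ p → (r + q * p) - (r + q′ * p) ≡ (q - q′) * p
  cancel = ℤ-Solver.solve-∀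

∣toℕ-toℕ∣≤ : ∀ {r} (i j : Fin (suc r)) → ℤ.∣ + toℕ i - + toℕ j ∣ ≤ r
∣toℕ-toℕ∣≤ {r} i j = subst (_≤ r) (cong ℤ.∣_∣ (sym (ℤP.[+m]-[+n]≡m⊖n (toℕ i) (toℕ j))))
                 (ℕP.≤-trans (ℤP.∣m⊝n∣≤m⊔n (toℕ i) (toℕ j)) (ℕP.⊔-lub (FinP.toℕ≤pred[n] i) (FinP.toℕ≤pred[n] j)))

thue-lemma : ∀ p .{{_ : ℕ.NonZero p}} r → p < suc r ℕ.* suc r → ∀ t →
                 ∃ λ v → v ≢ 0V × + p ∣ proj₁ v + t * proj₂ v × ℤ.∣ proj₁ v ∣ ≤ r × ℤ.∣ proj₂ v ∣ ≤ r
thue-lemma p r p<[r+1]² t = (a , b) , v≢0 , p∣a+tb , ∣toℕ-toℕ∣≤ i i′ , ∣toℕ-toℕ∣≤ j j′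
  where
  value : Fin (suc r ℕ.* suc r) → ℤ
  value x = + toℕ (proj₁ (remQuot {suc r} (suc r) x)) + t * + toℕ (proj₂ (remQuot {suc r} (suc r) x))
  residue : Fin (suc r ℕ.* suc r) → Fin p
  residue x = fromℕ< (n%ℕd<d (value x) p)
  collision : ∃₂ λ x y → x Fin.< y × residue x ≡ residue y
  collision = FinP.pigeonhole p<[r+1]² residue
  x : Fin (suc r ℕ.* suc r)
  x = proj₁ collision
  y : Fin (suc r ℕ.* suc r)
  y = proj₁ (proj₂ collision)
  i : Fin (suc r)
  i = proj₁ (remQuot {suc r} (suc r) x)
  j : Fin (suc r)
  j = proj₂ (remQuot {suc r} (suc r) x)
  i′ : Fin (suc r)
  i′ = proj₁ (remQuot {suc r} (suc r) y)
  j′ : Fin (suc r)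
  j′ = proj₂ (remQuot {suc r} (suc r) y)
  a : ℤ
  a = + toℕ i - + toℕ i′
  b : ℤ
  b = + toℕ j - + toℕ j′
  p∣a+tb : + p ∣ a + t * b
  p∣a+tb = ∣-respʳ (regroup (+ toℕ i) (+ toℕ j) (+ toℕ i′) (+ toℕ j′) t)
             (≡-%ℕ⇒∣- p (value x) (value y)
               (trans (sym (FinP.toℕ-fromℕ< (n%ℕd<d (value x) p)))
                 (trans (cong toℕ (proj₂ (proj₂ (proj₂ collision)))) (FinP.toℕ-fromℕ< (n%ℕd<d (value y) p)))))
    where
    regroup : ∀ i j i′ j′ t → (i + t * j) - (i′ + t * j′) ≡ (i - i′) + t * (j - j′)
    regroup = ℤ-Solver.solve-∀
  v≢0 : (a , b) ≢ 0V
  v≢0 v≡0 = ℕP.<-irrefl (cong toℕ x≡y) (proj₁ (proj₂ (proj₂ collision)))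
    where
    toℕ-cancel : ∀ (k l : Fin (suc r)) → + toℕ k - + toℕ l ≡ + 0 → k ≡ l
    toℕ-cancel k l k-l≡0 = FinP.toℕ-injective (ℤP.+-injective (ℤP.i-j≡0⇒i≡j (+ toℕ k) (+ toℕ l) k-l≡0))
    x≡y : x ≡ y
    x≡y = trans (sym (FinP.combine-remQuot {suc r} (suc r) x))
            (trans (cong₂ combine (toℕ-cancel i i′ (cong proj₁ v≡0)) (toℕ-cancel j j′ (cong proj₂ v≡0)))
              (FinP.combine-remQuot {suc r} (suc r) y))

thue-vector : ∀ {p} → Prime p → ∀ t → + p ∣ t * t + t + ℤ.1ℤ →
              ∃ λ v → v ≢ 0V × + p ∣ ‖ v ‖² × norm v < 3 ℕ.* p
thue-vector {p} pr t p∣t²+t+1 = small-vector (thue-lemma p r (proj₂ (proj₂ ⌊√ p ⌋)) t)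
  where
  instance _ = prime⇒nonZero pr
  r : ℕ
  r = proj₁ ⌊√ p ⌋
  r²<p : r ℕ.* r < p
  r²<p = ℕP.≤∧≢⇒< (proj₁ (proj₂ ⌊√ p ⌋)) (square≢prime pr r)
  small-vector : (∃ λ v → v ≢ 0V × + p ∣ proj₁ v + t * proj₂ v × ℤ.∣ proj₁ v ∣ ≤ r × ℤ.∣ proj₂ v ∣ ≤ r) →
                 ∃ λ v → v ≢ 0V × + p ∣ ‖ v ‖² × norm v < 3 ℕ.* p
  small-vector ((a , b) , v≢0 , p∣a+tb , ∣a∣≤r , ∣b∣≤r) = (a , b) , v≢0 , p∣‖v‖² , norm<3p
    where
    p∣‖v‖² : + p ∣ ‖ (a , b) ‖²
    p∣‖v‖² = ∣-respʳ (sym (identity a b t)) (∣m∣n⇒∣m+n (∣m⇒∣m*n (a - t * b - b) p∣a+tb) (∣n⇒∣m*n (b * b) p∣t²+t+1))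
      where
      identity : ∀ a b t → a * a - a * b + b * b ≡ (a + t * b) * (a - t * b - b) + (b * b) * (t * t + t + ℤ.1ℤ)
      identity = ℤ-Solver.solve-∀
    norm<3p : norm (a , b) < 3 ℕ.* p
    norm<3p = ℕP.≤-<-trans (norm≤ a b)
                (ℕP.≤-<-trans (ℕP.+-mono-≤ (ℕP.+-mono-≤ (ℕP.*-mono-≤ ∣a∣≤r ∣a∣≤r) (ℕP.*-mono-≤ ∣a∣≤r ∣b∣≤r)) (ℕP.*-mono-≤ ∣b∣≤r ∣b∣≤r))
                  (subst (r ℕ.* r ℕ.+ r ℕ.* r ℕ.+ r ℕ.* r <_) (three p) (ℕP.+-mono-< (ℕP.+-mono-< r²<p r²<p) r²<p)))
      where
      three : ∀ p → p ℕ.+ p ℕ.+ p ≡ 3 ℕ.* p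
      three = ℕ-Solver.solve-∀

norm≢2p : ∀ {p} → Prime p → p ≢ 2 → ∀ v → norm v ≢ 2 ℕ.* p
norm≢2p {p} pr p≢2 v norm≡2p = p≢2 (sym 2≡p)
  where
  halved : ∃ λ M → IsNorm M × norm v ≡ 2 ℕ.* 2 ℕ.* M
  halved = prime≡2∣norm prime[2] refl (v , ‖‖²≡norm v) (ℕD.divides p (trans norm≡2p (ℕP.*-comm 2 p)))
  M : ℕ
  M = proj₁ halved
  p≡2M : p ≡ 2 ℕ.* M
  p≡2M = ℕP.*-cancelˡ-≡ p (2 ℕ.* M) 2 (trans (sym norm≡2p) (trans (proj₂ (proj₂ halved)) (ℕP.*-assoc 2 2 M)))
  2≡p : 2 ≡ p
  2≡p = [ (λ ()) , id ]′ (prime⇒irreducible pr (ℕD.divides M (trans p≡2M (ℕP.*-comm 2 M))))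

prime≡1⇒IsNorm : ∀ {p} → Prime p → p % 3 ≡ 1 → IsNorm p
prime≡1⇒IsNorm {p} pr p%3≡1 = from-multiple (multiple-below-3p {p} {norm v} (∣⇒∣ᵤ p∣‖v‖²) norm<3p)
  where
  cube-root : ∃ λ t → + p ∣ t * t + t + ℤ.1ℤ
  cube-root = cube-root-of-unity pr p%3≡1
  thue : ∃ λ v → v ≢ 0V × + p ∣ ‖ v ‖² × norm v < 3 ℕ.* p
  thue = thue-vector pr (proj₁ cube-root) (proj₂ cube-root)
  v : V
  v = proj₁ thue
  p∣‖v‖² : + p ∣ ‖ v ‖²
  p∣‖v‖² = proj₁ (proj₂ (proj₂ thue))
  norm<3p : norm v < 3 ℕ.* p
  norm<3p = proj₂ (proj₂ (proj₂ thue))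
  from-multiple : norm v ≡ 0 ⊎ norm v ≡ p ⊎ norm v ≡ 2 ℕ.* p → IsNorm p
  from-multiple (inj₁ norm≡0)        = contradiction (‖‖²≡0⇒≡0V v (trans (‖‖²≡norm v) (cong +_ norm≡0))) (proj₁ (proj₂ thue))
  from-multiple (inj₂ (inj₁ norm≡p)) = v , trans (‖‖²≡norm v) (cong +_ norm≡p)
  from-multiple (inj₂ (inj₂ norm≡2p)) = contradiction norm≡2p (norm≢2p pr (λ { refl → contradiction p%3≡1 λ () }) v)

Admissible : ℕ → Set
Admissible G = ∃ λ u → ∃ λ j → ∃ λ d →
  (u ≡ 0 ⊎ u ≡ 1) × 1 ≤ j × 1 ≤ d × DistinctPrimes1mod3Product d × G ≡ 3 ℕ.^ u ℕ.* (j ℕ.* j) ℕ.* d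

Admissible-1 : Admissible 1
Admissible-1 = 0 , 1 , 1 , inj₁ refl , s≤s z≤n , s≤s z≤n , inj₁ refl , refl

Admissible-3* : ∀ {G} → Admissible G → Admissible (3 ℕ.* G)
Admissible-3* (0 , j , d , inj₁ refl , 1≤j , 1≤d , d-ok , refl) =
  1 , j , d , inj₂ refl , 1≤j , 1≤d , d-ok , identity j d
  where
  identity : ∀ j d → 3 ℕ.* (1 ℕ.* (j ℕ.* j) ℕ.* d) ≡ 3 ℕ.* (j ℕ.* j) ℕ.* d
  identity = ℕ-Solver.solve-∀
Admissible-3* (1 , j , d , inj₂ refl , 1≤j , 1≤d , d-ok , refl) =
  0 , 3 ℕ.* j , d , inj₁ refl , ℕP.≤-trans 1≤j (ℕP.m≤m+n j _) , 1≤d , d-ok , identity j d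
  where
  identity : ∀ j d → 3 ℕ.* (3 ℕ.* (j ℕ.* j) ℕ.* d) ≡ 1 ℕ.* ((3 ℕ.* j) ℕ.* (3 ℕ.* j)) ℕ.* d
  identity = ℕ-Solver.solve-∀

Admissible-square* : ∀ {G} q → 1 ≤ q → Admissible G → Admissible (q ℕ.* q ℕ.* G)
Admissible-square* q 1≤q (u , j , d , u≤1 , 1≤j , 1≤d , d-ok , refl) =
  u , q ℕ.* j , d , u≤1 , ℕP.*-mono-≤ 1≤q 1≤j , 1≤d , d-ok , identity q (3 ℕ.^ u) j d
  where
  identity : ∀ q U j d → q ℕ.* q ℕ.* (U ℕ.* (j ℕ.* j) ℕ.* d) ≡ U ℕ.* ((q ℕ.* j) ℕ.* (q ℕ.* j)) ℕ.* d
  identity = ℕ-Solver.solve-∀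

All-drop : ∀ {P : ℕ → Set} ys {p zs} → All P (ys ++ p ∷ zs) → All P (ys ++ zs)
All-drop ys all = ++⁺ (++⁻ˡ ys all) (All.tail (++⁻ʳ ys all))

Unique-drop : ∀ ys {p : ℕ} {zs} → Unique (ys ++ p ∷ zs) → Unique (ys ++ zs)
Unique-drop []       (_ ∷ uniq)  = uniq
Unique-drop (y ∷ ys) (y∉ ∷ uniq) = All-drop ys y∉ ∷ Unique-drop ys uniq

Admissible-prime* : ∀ {G p} → Prime p → p % 3 ≡ 1 → Admissible G → Admissible (p ℕ.* G)
Admissible-prime* {p = p} pr p%3≡1 (u , j , d , u≤1 , 1≤j , 1≤d , inj₁ refl , refl) =
  u , j , p , u≤1 , 1≤j , ℕP.<⇒≤ (prime≥2 pr) , inj₂ (p ∷ [] , pr ∷ [] , [] ∷ AllPairs.[] , p%3≡1 ∷ [] , ℕP.*-identityʳ p) ,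
  identity p (3 ℕ.^ u) j
  where
  identity : ∀ p U j → p ℕ.* (U ℕ.* (j ℕ.* j) ℕ.* 1) ≡ U ℕ.* (j ℕ.* j) ℕ.* p
  identity = ℕ-Solver.solve-∀
Admissible-prime* {p = p} pr p%3≡1 (u , j , d , u≤1 , 1≤j , 1≤d , inj₂ (ps , primes , uniq , ≡1 , refl) , refl)
  with p ∈? ps
... | no p∉ps =
  u , j , p ℕ.* product ps , u≤1 , 1≤j , productOfPrimes≥1 (pr ∷ primes) ,
  inj₂ (p ∷ ps , pr ∷ primes , ¬Any⇒All¬ ps p∉ps ∷ uniq , p%3≡1 ∷ ≡1 , refl) , identity p (3 ℕ.^ u) j (product ps)
  where
  identity : ∀ p U j d → p ℕ.* (U ℕ.* (j ℕ.* j) ℕ.* d) ≡ U ℕ.* (j ℕ.* j) ℕ.* (p ℕ.* d)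
  identity = ℕ-Solver.solve-∀
... | yes p∈ps with ∈-∃++ p∈ps
...   | ys , zs , refl =
  u , p ℕ.* j , product (ys ++ zs) , u≤1 , ℕP.*-mono-≤ (ℕP.<⇒≤ (prime≥2 pr)) 1≤j ,
  productOfPrimes≥1 (All-drop ys primes) , inj₂ (ys ++ zs , All-drop ys primes , Unique-drop ys uniq , All-drop ys ≡1 , refl) ,
  trans (cong (λ d → p ℕ.* (3 ℕ.^ u ℕ.* (j ℕ.* j) ℕ.* d)) (product-↭ (shift p ys zs))) (identity p (3 ℕ.^ u) j (product (ys ++ zs)))
  where
  identity : ∀ p U j d → p ℕ.* (U ℕ.* (j ℕ.* j) ℕ.* (p ℕ.* d)) ≡ U ℕ.* ((p ℕ.* j) ℕ.* (p ℕ.* j)) ℕ.* d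
  identity = ℕ-Solver.solve-∀

-- 3 = N(2 + ω) ramifies.
IsNorm-3*⇒IsNorm : ∀ n → IsNorm (3 ℕ.* n) → IsNorm n
IsNorm-3*⇒IsNorm n ((a , b) , ‖v‖²≡3n) = (a - q , q) , ℤP.*-cancelˡ-≡ (+ 3) _ (+ n) (begin
  + 3 * ‖ (a - q , q) ‖²   ≡⟨ sym (identity a q) ⟩
  ‖ (a , q * + 3 - a) ‖²   ≡⟨ cong (λ c → ‖ (a , c) ‖²) (sym b≡3q-a) ⟩
  ‖ (a , b) ‖²             ≡⟨ ‖v‖²≡3n ⟩
  + (3 ℕ.* n)              ≡⟨ ℤP.pos-* 3 n ⟩
  + 3 * + n                ∎)
  where
  open ≡-Reasoning
  3∣a+b : + 3 ∣ a + b
  3∣a+b = prime∣square prime[3] (a + b) (∣-respʳ (sym (square a b))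
            (∣m∣n⇒∣m+n (subst (+ 3 ∣_) (trans (sym (ℤP.pos-* 3 n)) (sym ‖v‖²≡3n)) (∣m⇒∣m*n (+ n) ∣-refl))
                          (∣m⇒∣m*n (a * b) ∣-refl)))
    where
    square : ∀ a b → (a + b) * (a + b) ≡ (a * a - a * b + b * b) + + 3 * (a * b)
    square = ℤ-Solver.solve-∀
  q : ℤ
  q = _∣_.quotient 3∣a+b
  b≡3q-a : b ≡ q * + 3 - a
  b≡3q-a = trans (cancel a b) (cong (_- a) (_∣_.equality 3∣a+b))
    where
    cancel : ∀ a b → b ≡ (a + b) - a
    cancel = ℤ-Solver.solve-∀
  identity : ∀ a q → a * a - a * (q * + 3 - a) + (q * + 3 - a) * (q * + 3 - a)
                     ≡ + 3 * ((a - q) * (a - q) - (a - q) * q + q * q)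
  identity = ℤ-Solver.solve-∀

NoPrimeFactor≡2 : ℕ → Set
NoPrimeFactor≡2 R = ∀ {p} → Prime p → p % 3 ≡ 2 → ¬ p ℕD.∣ R

AdmissibleIfNormFactor : ℕ → Set
AdmissibleIfNormFactor G = 1 ≤ G → ∀ R → NoPrimeFactor≡2 R → IsNorm (G ℕ.* R) → Admissible G

residues-mod-3 : ∀ n → n % 3 ≡ 0 ⊎ n % 3 ≡ 1 ⊎ n % 3 ≡ 2
residues-mod-3 n with n % 3 | m%n<n n 3
... | 0 | _ = inj₁ refl
... | 1 | _ = inj₂ (inj₁ refl)
... | 2 | _ = inj₂ (inj₂ refl)
... | suc (suc (suc _)) | s≤s (s≤s (s≤s ()))

prime-factor : ∀ G → 2 ≤ G → ∃ λ p → ∃ λ G′ → Prime p × G ≡ p ℕ.* G′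
prime-factor (suc zero) (s≤s ())
prime-factor G@(suc (suc _)) _ with factorise G
... | record { factors = p ∷ ps ; isFactorisation = G≡p*ps ; factorsPrime = pr ∷ _ } = p , product ps , pr , G≡p*ps

1≤m*n⇒1≤n : ∀ m {n} → 1 ≤ m ℕ.* n → 1 ≤ n
1≤m*n⇒1≤n m {zero}  1≤m*0 = contradiction (subst (1 ≤_) (ℕP.*-zeroʳ m) 1≤m*0) λ ()
1≤m*n⇒1≤n m {suc n} _ = s≤s z≤n

AdmissibleIfNormFactor-3* : ∀ {G} → AdmissibleIfNormFactor G → AdmissibleIfNormFactor (3 ℕ.* G)
AdmissibleIfNormFactor-3* {G} ih 1≤3G R R-ok 3GR-norm =
  Admissible-3* (ih (1≤m*n⇒1≤n 3 1≤3G) R R-ok (IsNorm-3*⇒IsNorm (G ℕ.* R) (subst IsNorm (ℕP.*-assoc 3 G R) 3GR-norm)))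

AdmissibleIfNormFactor-prime≡1* : ∀ {p G} → Prime p → p % 3 ≡ 1 → AdmissibleIfNormFactor G → AdmissibleIfNormFactor (p ℕ.* G)
AdmissibleIfNormFactor-prime≡1* {p} {G} pr p%3≡1 ih 1≤pG R R-ok pGR-norm =
  Admissible-prime* pr p%3≡1 (ih (1≤m*n⇒1≤n p 1≤pG) (p ℕ.* R) pR-ok (subst IsNorm (regroup p G R) pGR-norm))
  where
  regroup : ∀ p G R → p ℕ.* G ℕ.* R ≡ G ℕ.* (p ℕ.* R)
  regroup = ℕ-Solver.solve-∀
  pR-ok : NoPrimeFactor≡2 (p ℕ.* R)
  pR-ok {q} qr q%3≡2 q∣pR = [ q∤p , R-ok qr q%3≡2 ]′ (euclidsLemma p R qr q∣pR)
    where
    q∤p : ¬ q ℕD.∣ p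
    q∤p q∣p with prime⇒irreducible pr q∣p
    ... | inj₁ refl = ¬prime[1] qr
    ... | inj₂ refl = contradiction (trans (sym p%3≡1) q%3≡2) λ ()

AdmissibleIfNormFactor-prime≡2* : ∀ {p G} → Prime p → p % 3 ≡ 2 →
  (∀ {G′} → G ≡ p ℕ.* G′ → AdmissibleIfNormFactor G′) → AdmissibleIfNormFactor (p ℕ.* G)
AdmissibleIfNormFactor-prime≡2* {p} {G} pr p%3≡2 ih 1≤pG R R-ok pGR-norm =
  subst Admissible (sym pG≡ppG′) (Admissible-square* p (ℕP.<⇒≤ (prime≥2 pr)) (ih G≡pG′ 1≤G′ R R-ok (subst IsNorm M≡G′R M-norm)))
  where
  instance _ = prime⇒nonZero pr
  factored : ∃ λ M → IsNorm M × p ℕ.* G ℕ.* R ≡ p ℕ.* p ℕ.* M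
  factored = prime≡2∣norm pr p%3≡2 pGR-norm (ℕD.∣m⇒∣m*n R (ℕD.m∣m*n G))
  M : ℕ
  M = proj₁ factored
  M-norm : IsNorm M
  M-norm = proj₁ (proj₂ factored)
  GR≡pM : G ℕ.* R ≡ p ℕ.* M
  GR≡pM = ℕP.*-cancelˡ-≡ (G ℕ.* R) (p ℕ.* M) p
            (trans (sym (ℕP.*-assoc p G R)) (trans (proj₂ (proj₂ factored)) (ℕP.*-assoc p p M)))
  p∣G : p ℕD.∣ G
  p∣G = [ id , (λ p∣R → contradiction p∣R (R-ok pr p%3≡2)) ]′ (euclidsLemma G R pr (subst (p ℕD.∣_) (sym GR≡pM) (ℕD.m∣m*n M)))
  G′ : ℕ
  G′ = ℕD._∣_.quotient p∣G
  G≡pG′ : G ≡ p ℕ.* G′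
  G≡pG′ = trans (ℕD._∣_.equality p∣G) (ℕP.*-comm G′ p)
  pG≡ppG′ : p ℕ.* G ≡ p ℕ.* p ℕ.* G′
  pG≡ppG′ = trans (cong (p ℕ.*_) G≡pG′) (sym (ℕP.*-assoc p p G′))
  1≤G′ : 1 ≤ G′
  1≤G′ = 1≤m*n⇒1≤n p (subst (1 ≤_) G≡pG′ (1≤m*n⇒1≤n p 1≤pG))
  M≡G′R : M ≡ G′ ℕ.* R
  M≡G′R = ℕP.*-cancelˡ-≡ M (G′ ℕ.* R) p
            (trans (sym GR≡pM) (trans (cong (ℕ._* R) G≡pG′) (ℕP.*-assoc p G′ R)))

admissible-if-norm-factor : ∀ G → AdmissibleIfNormFactor G
admissible-if-norm-factor = <-rec AdmissibleIfNormFactor step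
  where
  step : ∀ G → (∀ {G′} → G′ < G → AdmissibleIfNormFactor G′) → AdmissibleIfNormFactor G
  step G ih 1≤G with G ℕ.≟ 1
  ... | yes refl = λ _ _ _ → Admissible-1
  ... | no G≢1 = subst AdmissibleIfNormFactor (sym G≡pG′) (by-residue (residues-mod-3 p)) 1≤G
    where
    factor : ∃ λ p → ∃ λ G′ → Prime p × G ≡ p ℕ.* G′
    factor = prime-factor G (ℕP.≤∧≢⇒< 1≤G (G≢1 ∘ sym))
    p : ℕ
    p = proj₁ factor
    G′ : ℕ
    G′ = proj₁ (proj₂ factor)
    pr : Prime p
    pr = proj₁ (proj₂ (proj₂ factor))
    G≡pG′ : G ≡ p ℕ.* G′
    G≡pG′ = proj₂ (proj₂ (proj₂ factor))
    smaller : ∀ {H K} → 1 ≤ p ℕ.* H → p ℕ.* H ≡ K → H < K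
    smaller {H} 1≤pH pH≡K = subst (H <_) (trans (ℕP.*-comm H p) pH≡K)
                              (ℕP.m<m*n H p {{ℕ.>-nonZero (1≤m*n⇒1≤n p 1≤pH)}} (prime≥2 pr))
    1≤pG′ : 1 ≤ p ℕ.* G′
    1≤pG′ = subst (1 ≤_) G≡pG′ 1≤G
    by-residue : p % 3 ≡ 0 ⊎ p % 3 ≡ 1 ⊎ p % 3 ≡ 2 → AdmissibleIfNormFactor (p ℕ.* G′)
    by-residue (inj₁ p%3≡0) = subst (λ q → AdmissibleIfNormFactor (q ℕ.* G′)) 3≡p
                                (AdmissibleIfNormFactor-3* {G′} (ih (smaller 1≤pG′ (sym G≡pG′))))
      where
      3≡p : 3 ≡ p
      3≡p = [ (λ ()) , id ]′ (prime⇒irreducible pr (ℕD.m%n≡0⇒n∣m p 3 p%3≡0))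
    by-residue (inj₂ (inj₁ p%3≡1)) = AdmissibleIfNormFactor-prime≡1* {p} {G′} pr p%3≡1 (ih (smaller 1≤pG′ (sym G≡pG′)))
    by-residue (inj₂ (inj₂ p%3≡2)) = AdmissibleIfNormFactor-prime≡2* {p} {G′} pr p%3≡2
      (λ {G″} G′≡pG″ → ih (ℕP.<-trans (smaller (subst (1 ≤_) G′≡pG″ (1≤m*n⇒1≤n p 1≤pG′)) (sym G′≡pG″))
                                      (smaller 1≤pG′ (sym G≡pG′))))

record ReducedBasis (N : ℕ) : Set where
  field
    x y       : V
    det≢0     : det x y ≢ + 0
    ∣det∣≡N   : ℤ.∣ det x y ∣ ≡ N
    norm-x≡y  : norm x ≡ norm y
    norm-x≤-  : norm x ≤ norm (x -V y)
    norm-x≤+  : norm x ≤ norm (x +V y)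

‖s·x+t·y‖² : ∀ s t x y → ‖ (s ·V x) +V (t ·V y) ‖²
                         ≡ s * s * ‖ x ‖² + s * t * (‖ x +V y ‖² - ‖ x ‖² - ‖ y ‖²) + t * t * ‖ y ‖²
‖s·x+t·y‖² s t (a , b) (c , d) = identity a b c d s t
  where
  identity : ∀ a b c d s t →
    (s * a + t * c) * (s * a + t * c) - (s * a + t * c) * (s * b + t * d) + (s * b + t * d) * (s * b + t * d) ≡
    s * s * (a * a - a * b + b * b)
      + s * t * (((a + c) * (a + c) - (a + c) * (b + d) + (b + d) * (b + d)) - (a * a - a * b + b * b) - (c * c - c * d + d * d))
      + t * t * (c * c - c * d + d * d)
  identity = ℤ-Solver.solve-∀

parallelogram : ∀ x y → ‖ x -V y ‖² + ‖ x +V y ‖² ≡ + 2 * ‖ x ‖² + + 2 * ‖ y ‖²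
parallelogram (a , b) (c , d) = identity a b c d
  where
  identity : ∀ a b c d → ((a - c) * (a - c) - (a - c) * (b - d) + (b - d) * (b - d)) + ((a + c) * (a + c) - (a + c) * (b + d) + (b + d) * (b + d))
                         ≡ + 2 * (a * a - a * b + b * b) + + 2 * (c * c - c * d + d * d)
  identity = ℤ-Solver.solve-∀

‖x-y‖²*‖x+y‖² : ∀ x y → ‖ x -V y ‖² * ‖ x +V y ‖² ≡ (‖ x ‖² - ‖ y ‖²) * (‖ x ‖² - ‖ y ‖²) + + 3 * (det x y * det x y)
‖x-y‖²*‖x+y‖² (a , b) (c , d) = identity a b c d
  where
  identity : ∀ a b c d → ((a - c) * (a - c) - (a - c) * (b - d) + (b - d) * (b - d)) * ((a + c) * (a + c) - (a + c) * (b + d) + (b + d) * (b + d))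
                         ≡ ((a * a - a * b + b * b) - (c * c - c * d + d * d)) * ((a * a - a * b + b * b) - (c * c - c * d + d * d))
                           + + 3 * ((a * d - b * c) * (a * d - b * c))
  identity = ℤ-Solver.solve-∀

det-comb : ∀ x y s t s′ t′ → det ((s ·V x) +V (t ·V y)) ((s′ ·V x) +V (t′ ·V y)) ≡ (s * t′ - t * s′) * det x y
det-comb (a , b) (c , d) s t s′ t′ = identity a b c d s t s′ t′
  where
  identity : ∀ a b c d s t s′ t′ → (s * a + t * c) * (s′ * b + t′ * d) - (s * b + t * d) * (s′ * a + t′ * c)
                                   ≡ (s * t′ - t * s′) * (a * d - b * c)
  identity = ℤ-Solver.solve-∀

det-0V : ∀ y → det 0V y ≡ + 0
det-0V (c , d) = identity c d
  where
  identity : ∀ c d → + 0 * d - + 0 * c ≡ + 0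
  identity = ℤ-Solver.solve-∀

det-swap : ∀ x y → det x y ≡ - det y x
det-swap (a , b) (c , d) = identity a b c d
  where
  identity : ∀ a b c d → a * d - b * c ≡ - (c * b - d * a)
  identity = ℤ-Solver.solve-∀

det--V : ∀ x y → det x y ≡ det (x -V y) y
det--V (a , b) (c , d) = identity a b c d
  where
  identity : ∀ a b c d → a * d - b * c ≡ (a - c) * d - (b - d) * c
  identity = ℤ-Solver.solve-∀

det-+V : ∀ x y → det x y ≡ det (x +V y) y
det-+V (a , b) (c , d) = identity a b c d
  where
  identity : ∀ a b c d → a * d - b * c ≡ (a + c) * d - (b + d) * c
  identity = ℤ-Solver.solve-∀

module _ {x y : V} (det≢0 : det x y ≢ + 0) where

  det≢0⇒x≢0 : x ≢ 0V
  det≢0⇒x≢0 refl = det≢0 (det-0V y)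

  det≢0⇒y≢0 : y ≢ 0V
  det≢0⇒y≢0 refl = det≢0 (trans (det-swap x 0V) (cong -_ (det-0V x)))

  det≢0⇒x-y≢0 : x -V y ≢ 0V
  det≢0⇒x-y≢0 x-y≡0 = det≢0 (trans (det--V x y) (trans (cong (λ z → det z y) x-y≡0) (det-0V y)))

  det≢0⇒x+y≢0 : x +V y ≢ 0V
  det≢0⇒x+y≢0 x+y≡0 = det≢0 (trans (det-+V x y) (trans (cong (λ z → det z y) x+y≡0) (det-0V y)))

∈-v₁ : ∀ Γ → v₁ Γ ∈ Γ
∈-v₁ Γ = + 1 , + 0 , cong₂ _,_ (identity (proj₁ (v₁ Γ)) (proj₁ (v₂ Γ))) (identity (proj₂ (v₁ Γ)) (proj₂ (v₂ Γ)))
  where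
  identity : ∀ a c → a ≡ + 1 * a + + 0 * c
  identity = ℤ-Solver.solve-∀

∈-v₂ : ∀ Γ → v₂ Γ ∈ Γ
∈-v₂ Γ = + 0 , + 1 , cong₂ _,_ (identity (proj₁ (v₁ Γ)) (proj₁ (v₂ Γ))) (identity (proj₂ (v₁ Γ)) (proj₂ (v₂ Γ)))
  where
  identity : ∀ a c → c ≡ + 0 * a + + 1 * c
  identity = ℤ-Solver.solve-∀

∈-+V : ∀ {Γ u w} → u ∈ Γ → w ∈ Γ → (u +V w) ∈ Γ
∈-+V {Γ} (s , t , refl) (s′ , t′ , refl) = s + s′ , t + t′ ,
  cong₂ _,_ (identity s t s′ t′ (proj₁ (v₁ Γ)) (proj₁ (v₂ Γ))) (identity s t s′ t′ (proj₂ (v₁ Γ)) (proj₂ (v₂ Γ)))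
  where
  identity : ∀ s t s′ t′ a c → (s * a + t * c) + (s′ * a + t′ * c) ≡ (s + s′) * a + (t + t′) * c
  identity = ℤ-Solver.solve-∀

∈--V : ∀ {Γ u w} → u ∈ Γ → w ∈ Γ → (u -V w) ∈ Γ
∈--V {Γ} (s , t , refl) (s′ , t′ , refl) = s - s′ , t - t′ ,
  cong₂ _,_ (identity s t s′ t′ (proj₁ (v₁ Γ)) (proj₁ (v₂ Γ))) (identity s t s′ t′ (proj₂ (v₁ Γ)) (proj₂ (v₂ Γ)))
  where
  identity : ∀ s t s′ t′ a c → (s * a + t * c) - (s′ * a + t′ * c) ≡ (s - s′) * a + (t - t′) * c
  identity = ℤ-Solver.solve-∀

norm≥1 : ∀ v → v ≢ 0V → 1 ≤ norm v
norm≥1 v v≢0 with norm v in eq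
... | zero  = contradiction (‖‖²≡0⇒≡0V v (trans (‖‖²≡norm v) (cong +_ eq))) v≢0
... | suc _ = s≤s z≤n

k≤n*k+m*c : ∀ {n} k m c → 1 ≤ n → + k ℤ.≤ + n * + k + + m * + c
k≤n*k+m*c {n} k m c 1≤n =
  subst (+ k ℤ.≤_) (sym (trans (cong₂ _+_ (sym (ℤP.pos-* n k)) (sym (ℤP.pos-* m c))) (sym (ℤP.pos-+ (n ℕ.* k) (m ℕ.* c)))))
                            (+≤+ (ℕP.≤-trans (ℕP.m≤n*m k n {{ℕ.>-nonZero 1≤n}}) (ℕP.m≤m+n (n ℕ.* k) (m ℕ.* c))))

+a-+b : ∀ {a b} → b ≤ a → + a - + b ≡ + (a ∸ b)
+a-+b {a} {b} b≤a = trans (ℤP.[+m]-[+n]≡m⊖n a b) (ℤP.⊖-≥ b≤a)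

norm-parallelogram : ∀ x y → norm x ≡ norm y → norm (x -V y) ℕ.+ norm (x +V y) ≡ 4 ℕ.* norm x
norm-parallelogram x y norm-x≡y = ℤP.+-injective (begin
  + (norm (x -V y) ℕ.+ norm (x +V y))        ≡⟨ ℤP.pos-+ (norm (x -V y)) (norm (x +V y)) ⟩
  + norm (x -V y) + + norm (x +V y)          ≡⟨ sym (cong₂ _+_ (‖‖²≡norm (x -V y)) (‖‖²≡norm (x +V y))) ⟩
  ‖ x -V y ‖² + ‖ x +V y ‖²                  ≡⟨ parallelogram x y ⟩
  + 2 * ‖ x ‖² + + 2 * ‖ y ‖²                ≡⟨ cong₂ (λ a b → + 2 * a + + 2 * b) (‖‖²≡norm x) (trans (‖‖²≡norm y) (cong +_ (sym norm-x≡y))) ⟩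
  + 2 * + norm x + + 2 * + norm x            ≡⟨ double (+ norm x) ⟩
  + 4 * + norm x                             ≡⟨ sym (ℤP.pos-* 4 (norm x)) ⟩
  + (4 ℕ.* norm x)                           ∎)
  where
  open ≡-Reasoning
  double : ∀ k → + 2 * k + + 2 * k ≡ + 4 * k
  double = ℤ-Solver.solve-∀

module _ {N : ℕ} (B : ReducedBasis N) where
  open ReducedBasis B

  reduced-basis-minimal : ∀ s t → (s , t) ≢ 0V → + norm x ℤ.≤ ‖ (s ·V x) +V (t ·V y) ‖²
  reduced-basis-minimal s t st≢0 = subst (+ k ℤ.≤_) (sym Q≡) (by-sign (s * t) refl)
    where
    k : ℕ
    k = norm x
    A₁ : ℕ
    A₁ = norm (x -V y)
    A₂ : ℕ
    A₂ = norm (x +V y)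
    Q : ℤ
    Q = s * s * + k + s * t * (+ A₂ - + k - + k) + t * t * + k
    Q≡ : ‖ (s ·V x) +V (t ·V y) ‖² ≡ Q
    Q≡ = trans (‖s·x+t·y‖² s t x y)
           (cong₃ (‖‖²≡norm x) (trans (‖‖²≡norm y) (cong +_ (sym norm-x≡y))) (‖‖²≡norm (x +V y)))
      where
      cong₃ : ∀ {p q r} → p ≡ + k → q ≡ + k → r ≡ + A₂ → s * s * p + s * t * (r - p - q) + t * t * q ≡ Q
      cong₃ refl refl refl = refl
    A₂≡4k-A₁ : + A₂ ≡ + 4 * + k - + A₁
    A₂≡4k-A₁ = trans (cancel (+ A₁) (+ A₂)) (cong (_- + A₁) (trans (sym (ℤP.pos-+ A₁ A₂))
                 (trans (cong +_ (norm-parallelogram x y norm-x≡y)) (ℤP.pos-* 4 k))))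
      where
      cancel : ∀ a b → b ≡ (a + b) - a
      cancel = ℤ-Solver.solve-∀
    by-sign : ∀ st → s * t ≡ st → + k ℤ.≤ Q
    by-sign (+ m) st≡m = subst (+ k ℤ.≤_) (sym (trans (rearrange s t (+ k) (+ A₂)) (cong₂ (λ n c → n * + k + c)
                           (‖‖²≡norm (s , t)) (cong₂ _*_ st≡m (+a-+b norm-x≤+)))))
                           (k≤n*k+m*c k m (A₂ ∸ k) (norm≥1 (s , t) st≢0))
      where
      rearrange : ∀ s t k A₂ → s * s * k + s * t * (A₂ - k - k) + t * t * k ≡ (s * s - s * t + t * t) * k + s * t * (A₂ - k)
      rearrange = ℤ-Solver.solve-∀
    by-sign -[1+ m ] st≡-m = subst (+ k ℤ.≤_) (sym (trans (cong (λ a → s * s * + k + s * t * (a - + k - + k) + t * t * + k) A₂≡4k-A₁)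
                               (trans (rearrange s t (+ k) (+ A₁)) (cong₂ (λ n c → n * + k + c)
                                 (‖‖²≡norm (s , - t)) (cong₂ _*_ (cong -_ st≡-m) (+a-+b norm-x≤-))))))
                               (k≤n*k+m*c k (suc m) (A₁ ∸ k) (norm≥1 (s , - t) s,-t≢0))
      where
      rearrange : ∀ s t k A₁ → s * s * k + s * t * ((+ 4 * k - A₁) - k - k) + t * t * k
                               ≡ (s * s - s * (- t) + (- t) * (- t)) * k + (- (s * t)) * (A₁ - k)
      rearrange = ℤ-Solver.solve-∀
      s,-t≢0 : (s , - t) ≢ 0V
      s,-t≢0 s,-t≡0 = st≢0 (cong₂ _,_ (cong proj₁ s,-t≡0) (trans (sym (ℤP.neg-involutive t)) (cong -_ (cong proj₂ s,-t≡0))))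

  ‖x‖²≡‖y‖² : ‖ x ‖² ≡ ‖ y ‖²
  ‖x‖²≡‖y‖² = trans (‖‖²≡norm x) (trans (cong +_ norm-x≡y) (sym (‖‖²≡norm y)))

  reduced-basis-index : InIndexSet N
  reduced-basis-index = Γ , (x , y , basis , minimal-x , minimal-y) , ∣det∣≡N
    where
    Γ : Sublattice
    Γ = ⟨ x , y ∣ det≢0 ⟩
    basis : IsBasisOf x y Γ
    basis = ∈-v₁ Γ , ∈-v₂ Γ , λ z z∈Γ → z∈Γ
    ‖x‖²≤ : ∀ z → z ∈ Γ → z ≢ 0V → ‖ x ‖² ℤ.≤ ‖ z ‖²
    ‖x‖²≤ z (s , t , refl) z≢0 = subst (ℤ._≤ ‖ z ‖²) (sym (‖‖²≡norm x)) (reduced-basis-minimal s t st≢0)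
      where
      st≢0 : (s , t) ≢ 0V
      st≢0 refl = z≢0 (cong₂ _,_ (identity (proj₁ x) (proj₁ y)) (identity (proj₂ x) (proj₂ y)))
        where
        identity : ∀ a c → + 0 * a + + 0 * c ≡ + 0
        identity = ℤ-Solver.solve-∀
    minimal-x : IsMinNorm Γ ‖ x ‖²
    minimal-x = (x , ∈-v₁ Γ , det≢0⇒x≢0 {x} {y} det≢0 , refl) , ‖x‖²≤
    minimal-y : IsMinNorm Γ ‖ y ‖²
    minimal-y = (y , ∈-v₂ Γ , det≢0⇒y≢0 {x} {y} det≢0 , refl) ,
                λ z z∈Γ z≢0 → subst (ℤ._≤ ‖ z ‖²) ‖x‖²≡‖y‖² (‖x‖²≤ z z∈Γ z≢0)

∣unit∣≡1 : ∀ X Y D → D ≢ + 0 → D ≡ X * (Y * D) → ℤ.∣ Y ∣ ≡ 1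
∣unit∣≡1 X Y D D≢0 D≡XYD = ℕP.m*n≡1⇒n≡1 ℤ.∣ X ∣ ℤ.∣ Y ∣ (trans (sym (ℤP.abs-* X Y)) (cong ℤ.∣_∣ XY≡1))
  where
  instance _ = ℤ.≢-nonZero D≢0
  XY≡1 : X * Y ≡ + 1
  XY≡1 = ℤP.*-cancelʳ-≡ (X * Y) (+ 1) D (trans (ℤP.*-assoc X Y D) (trans (sym D≡XYD) (sym (ℤP.*-identityˡ D))))

basis-det : ∀ {w₁ w₂} Γ → IsBasisOf w₁ w₂ Γ → det w₁ w₂ ≢ + 0 × ℤ.∣ det w₁ w₂ ∣ ≡ index Γ
basis-det {w₁} {w₂} Γ ((a , b , refl) , (a′ , b′ , refl) , spans) with spans (v₁ Γ) (∈-v₁ Γ) | spans (v₂ Γ) (∈-v₂ Γ)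
... | s , t , v₁≡ | s′ , t′ , v₂≡ = det-w≢0 , (begin
  ℤ.∣ det w₁ w₂ ∣                            ≡⟨ cong ℤ.∣_∣ det-w≡ ⟩
  ℤ.∣ (a * b′ - b * a′) * det-v ∣            ≡⟨ ℤP.abs-* (a * b′ - b * a′) det-v ⟩
  ℤ.∣ a * b′ - b * a′ ∣ ℕ.* ℤ.∣ det-v ∣      ≡⟨ cong (ℕ._* ℤ.∣ det-v ∣) (∣unit∣≡1 (s * t′ - t * s′) (a * b′ - b * a′) det-v (nondeg Γ) det-v≡) ⟩
  1 ℕ.* ℤ.∣ det-v ∣                          ≡⟨ ℕP.*-identityˡ _ ⟩
  index Γ                                    ∎)
  where
  open ≡-Reasoning
  det-v : ℤ
  det-v = det (v₁ Γ) (v₂ Γ)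
  det-w≡ : det w₁ w₂ ≡ (a * b′ - b * a′) * det-v
  det-w≡ = det-comb (v₁ Γ) (v₂ Γ) a b a′ b′
  det-v≡w : det-v ≡ (s * t′ - t * s′) * det w₁ w₂
  det-v≡w = trans (cong₂ det v₁≡ v₂≡) (det-comb w₁ w₂ s t s′ t′)
  det-v≡ : det-v ≡ (s * t′ - t * s′) * ((a * b′ - b * a′) * det-v)
  det-v≡ = trans det-v≡w (cong ((s * t′ - t * s′) *_) det-w≡)
  det-w≢0 : det w₁ w₂ ≢ + 0
  det-w≢0 det-w≡0 = nondeg Γ (trans det-v≡w (trans (cong ((s * t′ - t * s′) *_) det-w≡0) (ℤP.*-zeroʳ (s * t′ - t * s′))))

well-rounded⇒reduced-basis : ∀ {N} → InIndexSet N → ReducedBasis N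
well-rounded⇒reduced-basis (Γ , (w₁ , w₂ , basis@(w₁∈ , w₂∈ , _) , min₁ , min₂) , index≡N) = record
  { x         = w₁
  ; y         = w₂
  ; det≢0     = det≢0
  ; ∣det∣≡N   = trans (proj₂ (basis-det {w₁} {w₂} Γ basis)) index≡N
  ; norm-x≡y  = ℤP.+-injective (trans (sym (‖‖²≡norm w₁)) (trans ‖w₁‖²≡‖w₂‖² (‖‖²≡norm w₂)))
  ; norm-x≤-  = norm-w₁≤ (∈--V {Γ} w₁∈ w₂∈) (det≢0⇒x-y≢0 {w₁} {w₂} det≢0)
  ; norm-x≤+  = norm-w₁≤ (∈-+V {Γ} w₁∈ w₂∈) (det≢0⇒x+y≢0 {w₁} {w₂} det≢0)
  }
  where
  det≢0 : det w₁ w₂ ≢ + 0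
  det≢0 = proj₁ (basis-det {w₁} {w₂} Γ basis)
  ‖w₁‖²≡‖w₂‖² : ‖ w₁ ‖² ≡ ‖ w₂ ‖²
  ‖w₁‖²≡‖w₂‖² = ℤP.≤-antisym (proj₂ min₁ w₂ w₂∈ (det≢0⇒y≢0 {w₁} {w₂} det≢0))
                              (proj₂ min₂ w₁ w₁∈ (det≢0⇒x≢0 {w₁} {w₂} det≢0))
  norm-w₁≤ : ∀ {z} → z ∈ Γ → z ≢ 0V → norm w₁ ≤ norm z
  norm-w₁≤ {z} z∈Γ z≢0 = ℤP.drop‿+≤+ (subst₂ ℤ._≤_ (‖‖²≡norm w₁) (‖‖²≡norm z) (proj₂ min₁ z z∈Γ z≢0))

coprime-norm-NoPrimeFactor≡2 : ∀ {m n} → gcd m n ≡ 1 → NoPrimeFactor≡2 (norm (+ m , + n))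
coprime-norm-NoPrimeFactor≡2 {m} {n} gcd≡1 {p} pr p%3≡2 p∣norm = ¬prime[1] (subst Prime p≡1 pr)
  where
  p∣m,n : + p ∣ + m × + p ∣ + n
  p∣m,n = prime≡2∣‖‖² pr p%3≡2 (+ m) (+ n) (subst (_∣_ (+ p)) (sym (‖‖²≡norm (+ m , + n))) (∣ᵤ⇒∣ p∣norm))
  p≡1 : p ≡ 1
  p≡1 = ℕD.∣1⇒≡1 (subst (p ℕD.∣_) gcd≡1 (gcd-greatest (∣⇒∣ᵤ (proj₁ p∣m,n)) (∣⇒∣ᵤ (proj₂ p∣m,n))))

InFormulaSet-intro : ∀ {N f m n} → Admissible f → 1 ≤ m → 1 ≤ n → gcd m n ≡ 1 → ¬ 3 ℕD.∣ m ℕ.+ n →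
                     n ≤ m → m ≤ 2 ℕ.* n → N ≡ f ℕ.* (2 ℕ.* m ∸ n) ℕ.* n → InFormulaSet N
InFormulaSet-intro {m = m} {n} (u , j , d , u≤1 , 1≤j , 1≤d , d-ok , refl) 1≤m 1≤n gcd≡1 3∤m+n n≤m m≤2n N≡ =
  u , j , d , m , n , u≤1 , 1≤j , 1≤d , 1≤m , 1≤n , d-ok , gcd≡1 , 3∤m+n , n≤m , m≤2n , N≡

+[3s²+t²] : ∀ s t → + (3 ℕ.* (s ℕ.* s) ℕ.+ t ℕ.* t) ≡ + 3 * (+ s * + s) + + t * + t
+[3s²+t²] s t = begin
  + (3 ℕ.* (s ℕ.* s) ℕ.+ t ℕ.* t)          ≡⟨ ℤP.pos-+ (3 ℕ.* (s ℕ.* s)) (t ℕ.* t) ⟩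
  + (3 ℕ.* (s ℕ.* s)) + + (t ℕ.* t)        ≡⟨ cong₂ _+_ (trans (ℤP.pos-* 3 (s ℕ.* s)) (cong (+ 3 *_) (ℤP.pos-* s s))) (ℤP.pos-* t t) ⟩
  + 3 * (+ s * + s) + + t * + t            ∎
  where open ≡-Reasoning

m*m≤n*n⇒m≤n : ∀ {m n} → m ℕ.* m ≤ n ℕ.* n → m ≤ n
m*m≤n*n⇒m≤n {m} {n} m²≤n² with m ℕ.≤? n
... | yes m≤n = m≤n
... | no  m≰n = contradiction m²≤n² (ℕP.<⇒≱ (ℕP.*-mono-< (ℕP.≰⇒> m≰n) (ℕP.≰⇒> m≰n)))

4∣f*odd⇒4∣f : ∀ {f X} → ¬ 2 ℕD.∣ X → 4 ℕD.∣ f ℕ.* X → 4 ℕD.∣ f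
4∣f*odd⇒4∣f {f} {X} 2∤X (ℕD.divides q fX≡4q) =
  ℕD.divides g (trans f≡2f₁ (trans (cong (ℕ._* 2) (ℕD._∣_.equality 2∣f₁)) (ℕP.*-assoc g 2 2)))
  where
  2∣even : ∀ {a} → 2 ℕD.∣ a ℕ.* X → 2 ℕD.∣ a
  2∣even 2∣aX = [ id , (λ 2∣X → contradiction 2∣X 2∤X) ]′ (euclidsLemma _ X prime[2] 2∣aX)
  2∣f : 2 ℕD.∣ f
  2∣f = 2∣even (ℕD.divides (q ℕ.* 2) (trans fX≡4q (sym (ℕP.*-assoc q 2 2))))
  f₁ : ℕ
  f₁ = ℕD._∣_.quotient 2∣f
  f≡2f₁ : f ≡ f₁ ℕ.* 2
  f≡2f₁ = ℕD._∣_.equality 2∣f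
  2∣f₁ : 2 ℕD.∣ f₁
  2∣f₁ = 2∣even (ℕD.divides q (ℕP.*-cancelʳ-≡ (f₁ ℕ.* X) (q ℕ.* 2) 2 (trans (regroup f₁ X) (trans (cong (ℕ._* X) (sym f≡2f₁))
           (trans fX≡4q (sym (ℕP.*-assoc q 2 2)))))))
    where
    regroup : ∀ f₁ X → f₁ ℕ.* X ℕ.* 2 ≡ f₁ ℕ.* 2 ℕ.* X
    regroup = ℕ-Solver.solve-∀
  g : ℕ
  g = ℕD._∣_.quotient 2∣f₁

4*norm[m,s] : ∀ {m s t} → s ℕ.+ t ≡ m ℕ.* 2 → 4 ℕ.* norm (+ m , + s) ≡ 3 ℕ.* (s ℕ.* s) ℕ.+ t ℕ.* t
4*norm[m,s] {m} {s} {t} s+t≡2m = ℤP.+-injective (begin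
  + (4 ℕ.* norm (+ m , + s))                                    ≡⟨ ℤP.pos-* 4 (norm (+ m , + s)) ⟩
  + 4 * + norm (+ m , + s)                                      ≡⟨ cong (+ 4 *_) (sym (‖‖²≡norm (+ m , + s))) ⟩
  + 4 * ‖ (+ m , + s) ‖²                                        ≡⟨ identity (+ m) (+ s) ⟩
  + 3 * (+ s * + s) + (+ m * + 2 - + s) * (+ m * + 2 - + s)     ≡⟨ cong (λ u → + 3 * (+ s * + s) + u * u) (sym t≡2m-s) ⟩
  + 3 * (+ s * + s) + + t * + t                                 ≡⟨ sym (+[3s²+t²] s t) ⟩
  + (3 ℕ.* (s ℕ.* s) ℕ.+ t ℕ.* t)                               ∎)
  where
  open ≡-Reasoning
  identity : ∀ m s → + 4 * (m * m - m * s + s * s) ≡ + 3 * (s * s) + (m * + 2 - s) * (m * + 2 - s)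
  identity = ℤ-Solver.solve-∀
  t≡2m-s : + t ≡ + m * + 2 - + s
  t≡2m-s = trans (cancel (+ s) (+ t)) (cong (_- + s) (trans (sym (ℤP.pos-+ s t)) (trans (cong +_ s+t≡2m) (ℤP.pos-* m 2))))
    where
    cancel : ∀ a b → b ≡ (a + b) - a
    cancel = ℤ-Solver.solve-∀

norm[s+t,2s] : ∀ s t → norm (+ (s ℕ.+ t) , + (2 ℕ.* s)) ≡ 3 ℕ.* (s ℕ.* s) ℕ.+ t ℕ.* t
norm[s+t,2s] s t = ℤP.+-injective (begin
  + norm (+ (s ℕ.+ t) , + (2 ℕ.* s))          ≡⟨ sym (‖‖²≡norm (+ (s ℕ.+ t) , + (2 ℕ.* s))) ⟩
  ‖ (+ (s ℕ.+ t) , + (2 ℕ.* s)) ‖²            ≡⟨ cong₂ (λ a b → ‖ (a , b) ‖²) (ℤP.pos-+ s t) (ℤP.pos-* 2 s) ⟩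
  ‖ (+ s + + t , + 2 * + s) ‖²                ≡⟨ identity (+ s) (+ t) ⟩
  + 3 * (+ s * + s) + + t * + t               ≡⟨ sym (+[3s²+t²] s t) ⟩
  + (3 ℕ.* (s ℕ.* s) ℕ.+ t ℕ.* t)             ∎)
  where
  open ≡-Reasoning
  identity : ∀ s t → (s + t) * (s + t) - (s + t) * (+ 2 * s) + (+ 2 * s) * (+ 2 * s) ≡ + 3 * (s * s) + t * t
  identity = ℤ-Solver.solve-∀

gcd[m,s]≡1 : ∀ {m s t} → Coprime s t → s ℕ.+ t ≡ m ℕ.* 2 → gcd m s ≡ 1
gcd[m,s]≡1 {m} {s} coprime s+t≡2m = coprime⇒gcd≡1 {m} {s} λ {d} (d∣m , d∣s) →
  coprime (d∣s , ℕD.∣m+n∣m⇒∣n (subst (d ℕD.∣_) (sym s+t≡2m) (ℕD.∣m⇒∣m*n 2 d∣m)) d∣s)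

gcd[s+t,2s]≡1 : ∀ {s t} → Coprime s t → ¬ 2 ℕD.∣ s ℕ.+ t → gcd (s ℕ.+ t) (2 ℕ.* s) ≡ 1
gcd[s+t,2s]≡1 {s} {t} coprime 2∤s+t = coprime⇒gcd≡1 {s ℕ.+ t} {2 ℕ.* s} λ {d} (d∣s+t , d∣2s) →
  coprime (d∣s d∣s+t d∣2s , ℕD.∣m+n∣m⇒∣n d∣s+t (d∣s d∣s+t d∣2s))
  where
  d∣s : ∀ {d} → d ℕD.∣ s ℕ.+ t → d ℕD.∣ 2 ℕ.* s → d ℕD.∣ s
  d∣s {d} d∣s+t d∣2s = coprime-divisor {d} {2} {s} (λ {c} (c∣d , c∣2) →
    [ id , (λ c≡2 → contradiction (subst (ℕD._∣ s ℕ.+ t) c≡2 (ℕD.∣-trans c∣d d∣s+t)) 2∤s+t) ]′ (prime⇒irreducible prime[2] c∣2)) d∣2s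

2∤3s²+t² : ∀ {s t} → ¬ 2 ℕD.∣ s ℕ.+ t → ¬ 2 ℕD.∣ 3 ℕ.* (s ℕ.* s) ℕ.+ t ℕ.* t
2∤3s²+t² {s} {t} 2∤s+t 2∣X = 2∤s+t ([ id , id ]′ (euclidsLemma (s ℕ.+ t) (s ℕ.+ t) prime[2] 2∣[s+t]²))
  where
  regroup : ∀ s t → 3 ℕ.* (s ℕ.* s) ℕ.+ t ℕ.* t ℕ.+ 2 ℕ.* (s ℕ.* t) ≡ 2 ℕ.* (s ℕ.* s) ℕ.+ (s ℕ.+ t) ℕ.* (s ℕ.+ t)
  regroup = ℕ-Solver.solve-∀
  2∣[s+t]² : 2 ℕD.∣ (s ℕ.+ t) ℕ.* (s ℕ.+ t)
  2∣[s+t]² = ℕD.∣m+n∣m⇒∣n (subst (2 ℕD.∣_) (regroup s t) (ℕD.∣m∣n⇒∣m+n 2∣X (ℕD.m∣m*n (s ℕ.* t)))) (ℕD.m∣m*n (s ℕ.* s))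

-- {‖x - y‖², ‖x + y‖²} = {3 f s², f t²} and N = f s t.
record NormSplit (k N : ℕ) : Set where
  field
    f s t     : ℕ
    1≤f       : 1 ≤ f
    1≤s       : 1 ≤ s
    coprime   : Coprime s t
    3∤t       : ¬ 3 ℕD.∣ t
    sum≡4k    : 3 ℕ.* f ℕ.* (s ℕ.* s) ℕ.+ f ℕ.* (t ℕ.* t) ≡ 4 ℕ.* k
    k≤3fs²    : k ≤ 3 ℕ.* f ℕ.* (s ℕ.* s)
    k≤ft²     : k ≤ f ℕ.* (t ℕ.* t)
    N≡fst     : N ≡ f ℕ.* s ℕ.* t

module _ {k N} (S : NormSplit k N) (k-norm : IsNorm k) where
  open NormSplit S

  private

    X : ℕ
    X = 3 ℕ.* (s ℕ.* s) ℕ.+ t ℕ.* t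

    4k≡fX : 4 ℕ.* k ≡ f ℕ.* X
    4k≡fX = trans (sym sum≡4k) (factor f s t)
      where
      factor : ∀ f s t → 3 ℕ.* f ℕ.* (s ℕ.* s) ℕ.+ f ℕ.* (t ℕ.* t) ≡ f ℕ.* (3 ℕ.* (s ℕ.* s) ℕ.+ t ℕ.* t)
      factor = ℕ-Solver.solve-∀

    s≤t : s ≤ t
    s≤t = m*m≤n*n⇒m≤n (ℕP.*-cancelˡ-≤ (3 ℕ.* f) {{ℕ.>-nonZero (ℕP.≤-trans 1≤f (ℕP.m≤m+n f _))}}
            (ℕP.+-cancelʳ-≤ (f ℕ.* (t ℕ.* t)) _ _ (subst₂ _≤_ (sym sum≡4k) (split f t) (ℕP.*-monoʳ-≤ 4 k≤ft²))))
      where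
      split : ∀ f t → 4 ℕ.* (f ℕ.* (t ℕ.* t)) ≡ 3 ℕ.* f ℕ.* (t ℕ.* t) ℕ.+ f ℕ.* (t ℕ.* t)
      split = ℕ-Solver.solve-∀

    t≤3s : t ≤ 3 ℕ.* s
    t≤3s = m*m≤n*n⇒m≤n (ℕP.*-cancelˡ-≤ f {{ℕ.>-nonZero 1≤f}} (subst (f ℕ.* (t ℕ.* t) ≤_) (regroup f s)
             (ℕP.+-cancelˡ-≤ (3 ℕ.* f ℕ.* (s ℕ.* s)) _ _ (subst₂ _≤_ (sym sum≡4k) (split f s) (ℕP.*-monoʳ-≤ 4 k≤3fs²)))))
      where
      split : ∀ f s → 4 ℕ.* (3 ℕ.* f ℕ.* (s ℕ.* s)) ≡ 3 ℕ.* f ℕ.* (s ℕ.* s) ℕ.+ 9 ℕ.* f ℕ.* (s ℕ.* s)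
      split = ℕ-Solver.solve-∀
      regroup : ∀ f s → 9 ℕ.* f ℕ.* (s ℕ.* s) ≡ f ℕ.* ((3 ℕ.* s) ℕ.* (3 ℕ.* s))
      regroup = ℕ-Solver.solve-∀

    k≡f*R : ∀ R → 4 ℕ.* R ≡ X → k ≡ f ℕ.* R
    k≡f*R R 4R≡X = ℕP.*-cancelˡ-≡ k (f ℕ.* R) 4 (trans 4k≡fX (trans (cong (f ℕ.*_) (sym 4R≡X)) (regroup f R)))
      where
      regroup : ∀ f R → f ℕ.* (4 ℕ.* R) ≡ 4 ℕ.* (f ℕ.* R)
      regroup = ℕ-Solver.solve-∀

    3∤3s+t : ¬ 3 ℕD.∣ 3 ℕ.* s ℕ.+ t
    3∤3s+t 3∣3s+t = 3∤t (ℕD.∣m+n∣m⇒∣n 3∣3s+t (ℕD.m∣m*n s))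

    formula-even : ∀ m → s ℕ.+ t ≡ m ℕ.* 2 → InFormulaSet N
    formula-even m s+t≡2m = InFormulaSet-intro f-admissible (ℕP.≤-trans 1≤s s≤m) 1≤s gcd≡1 3∤m+s s≤m m≤2s N≡
      where
      R : ℕ
      R = norm (+ m , + s)
      gcd≡1 : gcd m s ≡ 1
      gcd≡1 = gcd[m,s]≡1 {m} {s} {t} coprime s+t≡2m
      f-admissible : Admissible f
      f-admissible = admissible-if-norm-factor f 1≤f R (coprime-norm-NoPrimeFactor≡2 {m} {s} gcd≡1)
                       (subst IsNorm (k≡f*R R (4*norm[m,s] {m} {s} {t} s+t≡2m)) k-norm)
      3∤m+s : ¬ 3 ℕD.∣ m ℕ.+ s
      3∤m+s 3∣m+s = 3∤3s+t (subst (3 ℕD.∣_) [m+s]*2≡3s+t (ℕD.∣m⇒∣m*n 2 3∣m+s))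
        where
        [m+s]*2≡3s+t : (m ℕ.+ s) ℕ.* 2 ≡ 3 ℕ.* s ℕ.+ t
        [m+s]*2≡3s+t = trans (ℕP.*-distribʳ-+ 2 m s) (trans (cong (ℕ._+ s ℕ.* 2) (sym s+t≡2m)) (regroup s t))
          where
          regroup : ∀ s t → s ℕ.+ t ℕ.+ s ℕ.* 2 ≡ 3 ℕ.* s ℕ.+ t
          regroup = ℕ-Solver.solve-∀
      s≤m : s ≤ m
      s≤m = ℕP.*-cancelʳ-≤ s m 2 (subst₂ _≤_ (double s) s+t≡2m (ℕP.+-monoʳ-≤ s s≤t))
        where
        double : ∀ s → s ℕ.+ s ≡ s ℕ.* 2
        double = ℕ-Solver.solve-∀
      m≤2s : m ≤ 2 ℕ.* s
      m≤2s = ℕP.*-cancelʳ-≤ m (2 ℕ.* s) 2 (subst₂ _≤_ s+t≡2m (quadruple s) (ℕP.+-monoʳ-≤ s t≤3s))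
        where
        quadruple : ∀ s → s ℕ.+ 3 ℕ.* s ≡ 2 ℕ.* s ℕ.* 2
        quadruple = ℕ-Solver.solve-∀
      N≡ : N ≡ f ℕ.* (2 ℕ.* m ∸ s) ℕ.* s
      N≡ = trans N≡fst (trans (swap f s t) (cong (λ u → f ℕ.* u ℕ.* s) (sym 2m-s≡t)))
        where
        2m-s≡t : 2 ℕ.* m ∸ s ≡ t
        2m-s≡t = trans (cong (_∸ s) (trans (ℕP.*-comm 2 m) (sym s+t≡2m))) (ℕP.m+n∸m≡n s t)
        swap : ∀ f s t → f ℕ.* s ℕ.* t ≡ f ℕ.* t ℕ.* s
        swap = ℕ-Solver.solve-∀

    formula-odd : ¬ 2 ℕD.∣ s ℕ.+ t → InFormulaSet N
    formula-odd 2∤s+t = InFormulaSet-intro g-admissible 1≤m 1≤n gcd≡1 3∤m+n n≤m m≤2n N≡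
      where
      m : ℕ
      m = s ℕ.+ t
      n : ℕ
      n = 2 ℕ.* s
      1≤m : 1 ≤ m
      1≤m = ℕP.≤-trans 1≤s (ℕP.m≤m+n s t)
      1≤n : 1 ≤ n
      1≤n = ℕP.≤-trans 1≤s (ℕP.m≤m+n s _)
      4∣f : 4 ℕD.∣ f
      4∣f = 4∣f*odd⇒4∣f {f} {X} (2∤3s²+t² {s} {t} 2∤s+t) (ℕD.divides k (trans (sym 4k≡fX) (ℕP.*-comm 4 k)))
      g : ℕ
      g = ℕD._∣_.quotient 4∣f
      f≡4g : f ≡ g ℕ.* 4
      f≡4g = ℕD._∣_.equality 4∣f
      R : ℕ
      R = norm (+ m , + n)
      k≡gR : k ≡ g ℕ.* R
      k≡gR = ℕP.*-cancelˡ-≡ k (g ℕ.* R) 4 (trans 4k≡fX (trans (cong₂ ℕ._*_ f≡4g (sym (norm[s+t,2s] s t))) (regroup g R)))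
        where
        regroup : ∀ g R → g ℕ.* 4 ℕ.* R ≡ 4 ℕ.* (g ℕ.* R)
        regroup = ℕ-Solver.solve-∀
      gcd≡1 : gcd m n ≡ 1
      gcd≡1 = gcd[s+t,2s]≡1 {s} {t} coprime 2∤s+t
      g-admissible : Admissible g
      g-admissible = admissible-if-norm-factor g (1≤m*n⇒1≤n 4 (subst (1 ≤_) (trans f≡4g (ℕP.*-comm g 4)) 1≤f)) R
                       (coprime-norm-NoPrimeFactor≡2 {m} {n} gcd≡1) (subst IsNorm k≡gR k-norm)
      3∤m+n : ¬ 3 ℕD.∣ m ℕ.+ n
      3∤m+n = 3∤3s+t ∘ subst (3 ℕD.∣_) (regroup s t)
        where
        regroup : ∀ s t → s ℕ.+ t ℕ.+ 2 ℕ.* s ≡ 3 ℕ.* s ℕ.+ t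
        regroup = ℕ-Solver.solve-∀
      n≤m : n ≤ m
      n≤m = subst (_≤ m) (double s) (ℕP.+-monoʳ-≤ s s≤t)
        where
        double : ∀ s → s ℕ.+ s ≡ 2 ℕ.* s
        double = ℕ-Solver.solve-∀
      m≤2n : m ≤ 2 ℕ.* n
      m≤2n = subst (m ≤_) (quadruple s) (ℕP.+-monoʳ-≤ s t≤3s)
        where
        quadruple : ∀ s → s ℕ.+ 3 ℕ.* s ≡ 2 ℕ.* (2 ℕ.* s)
        quadruple = ℕ-Solver.solve-∀
      N≡ : N ≡ g ℕ.* (2 ℕ.* m ∸ n) ℕ.* n
      N≡ = trans N≡fst (trans (cong (λ u → u ℕ.* s ℕ.* t) f≡4g) (trans (regroup g s t) (cong (λ u → g ℕ.* u ℕ.* n) (sym 2m-n≡2t))))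
        where
        2m-n≡2t : 2 ℕ.* m ∸ n ≡ 2 ℕ.* t
        2m-n≡2t = trans (cong (_∸ n) (ℕP.*-distribˡ-+ 2 s t)) (ℕP.m+n∸m≡n (2 ℕ.* s) (2 ℕ.* t))
        regroup : ∀ g s t → g ℕ.* 4 ℕ.* s ℕ.* t ≡ g ℕ.* (2 ℕ.* t) ℕ.* (2 ℕ.* s)
        regroup = ℕ-Solver.solve-∀

  norm-split-formula : InFormulaSet N
  norm-split-formula with 2 ℕD.∣? s ℕ.+ t
  ... | yes (ℕD.divides m s+t≡2m) = formula-even m s+t≡2m
  ... | no  2∤s+t              = formula-odd 2∤s+t

module _ {k A₁ A₂ N} (A₁+A₂≡4k : A₁ ℕ.+ A₂ ≡ 4 ℕ.* k) (A₁A₂≡3N² : A₁ ℕ.* A₂ ≡ 3 ℕ.* (N ℕ.* N))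
         (k≤A₁ : k ≤ A₁) (k≤A₂ : k ≤ A₂) (1≤N : 1 ≤ N) where

  private
    e : ℕ
    e = gcd N A₂
    instance e≢0 : ℕ.NonZero e
    e≢0 = ℕ.≢-nonZero (gcd[m,n]≢0 N A₂ (inj₁ (λ N≡0 → ℕP.<⇒≱ 1≤N (ℕP.≤-reflexive N≡0))))
    α : ℕ
    α = N ℕ./ e
    β : ℕ
    β = A₂ ℕ./ e
    N≡αe : N ≡ α ℕ.* e
    N≡αe = sym (m/n*n≡m (gcd[m,n]∣m N A₂))
    A₂≡βe : A₂ ≡ β ℕ.* e
    A₂≡βe = sym (m/n*n≡m (gcd[m,n]∣n N A₂))
    coprime-αβ : Coprime α β
    coprime-αβ = coprime-/gcd N A₂
    1≤α : 1 ≤ α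
    1≤α = 1≤m*n⇒1≤n e (subst (1 ≤_) (trans N≡αe (ℕP.*-comm α e)) 1≤N)
    A₁β≡3eα² : A₁ ℕ.* β ≡ 3 ℕ.* e ℕ.* (α ℕ.* α)
    A₁β≡3eα² = ℕP.*-cancelʳ-≡ (A₁ ℕ.* β) (3 ℕ.* e ℕ.* (α ℕ.* α)) e (begin
      A₁ ℕ.* β ℕ.* e                  ≡⟨ ℕP.*-assoc A₁ β e ⟩
      A₁ ℕ.* (β ℕ.* e)                ≡⟨ cong (A₁ ℕ.*_) (sym A₂≡βe) ⟩
      A₁ ℕ.* A₂                       ≡⟨ A₁A₂≡3N² ⟩
      3 ℕ.* (N ℕ.* N)                 ≡⟨ cong (λ n → 3 ℕ.* (n ℕ.* n)) N≡αe ⟩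
      3 ℕ.* (α ℕ.* e ℕ.* (α ℕ.* e))   ≡⟨ regroup α e ⟩
      3 ℕ.* e ℕ.* (α ℕ.* α) ℕ.* e     ∎)
      where
      open ≡-Reasoning
      regroup : ∀ α e → 3 ℕ.* (α ℕ.* e ℕ.* (α ℕ.* e)) ≡ 3 ℕ.* e ℕ.* (α ℕ.* α) ℕ.* e
      regroup = ℕ-Solver.solve-∀
    β∣3e : β ℕD.∣ 3 ℕ.* e
    β∣3e = coprime-divisor (Cop.sym coprime-αβ) (coprime-divisor (Cop.sym coprime-αβ)
             (ℕD.divides A₁ (trans (regroup α e) (sym A₁β≡3eα²))))
      where
      regroup : ∀ α e → α ℕ.* (α ℕ.* (3 ℕ.* e)) ≡ 3 ℕ.* e ℕ.* (α ℕ.* α)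
      regroup = ℕ-Solver.solve-∀
    1≤β : 1 ≤ β
    1≤β = 1≤m*n⇒1≤n e (subst (1 ≤_) (trans A₂≡βe (ℕP.*-comm β e)) 1≤A₂)
      where
      1≤A₂ : 1 ≤ A₂
      1≤A₂ = 1≤m*n⇒1≤n A₁ (subst (1 ≤_) (sym A₁A₂≡3N²) (ℕP.*-mono-≤ {1} {3} (s≤s z≤n) (ℕP.*-mono-≤ 1≤N 1≤N)))

    split-3∤β : ¬ 3 ℕD.∣ β → NormSplit k N
    split-3∤β 3∤β = record
      { f = f ; s = α ; t = β ; 1≤f = 1≤f ; 1≤s = 1≤α ; coprime = coprime-αβ ; 3∤t = 3∤β
      ; sum≡4k = trans (cong₂ ℕ._+_ (sym A₁≡3fα²) (sym A₂≡fβ²)) A₁+A₂≡4k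
      ; k≤3fs² = subst (k ≤_) A₁≡3fα² k≤A₁
      ; k≤ft²  = subst (k ≤_) A₂≡fβ² k≤A₂
      ; N≡fst  = trans N≡αe (trans (cong (α ℕ.*_) e≡fβ) (regroup α f β))
      }
      where
      β∣e : β ℕD.∣ e
      β∣e = coprime-divisor (λ {c} (c∣β , c∣3) → [ id , (λ c≡3 → contradiction (subst (ℕD._∣ β) c≡3 c∣β) 3∤β) ]′
                                                    (prime⇒irreducible prime[3] c∣3)) β∣3e
      f : ℕ
      f = ℕD._∣_.quotient β∣e
      e≡fβ : e ≡ f ℕ.* β
      e≡fβ = ℕD._∣_.equality β∣e
      1≤f : 1 ≤ f
      1≤f = 1≤m*n⇒1≤n β (subst (1 ≤_) (trans e≡fβ (ℕP.*-comm f β)) (ℕ.>-nonZero⁻¹ e))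
      A₁≡3fα² : A₁ ≡ 3 ℕ.* f ℕ.* (α ℕ.* α)
      A₁≡3fα² = ℕP.*-cancelʳ-≡ A₁ (3 ℕ.* f ℕ.* (α ℕ.* α)) β {{ℕ.>-nonZero 1≤β}}
                  (trans A₁β≡3eα² (trans (cong (λ u → 3 ℕ.* u ℕ.* (α ℕ.* α)) e≡fβ) (regroup′ f β α)))
        where
        regroup′ : ∀ f β α → 3 ℕ.* (f ℕ.* β) ℕ.* (α ℕ.* α) ≡ 3 ℕ.* f ℕ.* (α ℕ.* α) ℕ.* β
        regroup′ = ℕ-Solver.solve-∀
      A₂≡fβ² : A₂ ≡ f ℕ.* (β ℕ.* β)
      A₂≡fβ² = trans A₂≡βe (trans (cong (β ℕ.*_) e≡fβ) (regroup′ f β))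
        where
        regroup′ : ∀ f β → β ℕ.* (f ℕ.* β) ≡ f ℕ.* (β ℕ.* β)
        regroup′ = ℕ-Solver.solve-∀
      regroup : ∀ α f β → α ℕ.* (f ℕ.* β) ≡ f ℕ.* α ℕ.* β
      regroup = ℕ-Solver.solve-∀

    split-3∣β : ∀ β′ → β ≡ β′ ℕ.* 3 → NormSplit k N
    split-3∣β β′ β≡3β′ = record
      { f = f ; s = β′ ; t = α ; 1≤f = 1≤f ; 1≤s = 1≤β′ ; coprime = coprime-β′α ; 3∤t = 3∤α
      ; sum≡4k = trans (cong₂ ℕ._+_ (sym A₂≡3fβ′²) (sym A₁≡fα²)) (trans (ℕP.+-comm A₂ A₁) A₁+A₂≡4k)
      ; k≤3fs² = subst (k ≤_) A₂≡3fβ′² k≤A₂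
      ; k≤ft²  = subst (k ≤_) A₁≡fα² k≤A₁
      ; N≡fst  = trans N≡αe (trans (cong (α ℕ.*_) e≡fβ′) (regroup α f β′))
      }
      where
      1≤β′ : 1 ≤ β′
      1≤β′ = 1≤m*n⇒1≤n 3 (subst (1 ≤_) (trans β≡3β′ (ℕP.*-comm β′ 3)) 1≤β)
      coprime-β′α : Coprime β′ α
      coprime-β′α (c∣β′ , c∣α) = coprime-αβ (c∣α , ℕD.∣-trans c∣β′ (ℕD.divides 3 (trans β≡3β′ (ℕP.*-comm β′ 3))))
      3∤α : ¬ 3 ℕD.∣ α
      3∤α 3∣α = contradiction (coprime-αβ (3∣α , ℕD.divides β′ β≡3β′)) λ ()
      A₁β′≡eα² : A₁ ℕ.* β′ ≡ e ℕ.* (α ℕ.* α)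
      A₁β′≡eα² = ℕP.*-cancelʳ-≡ (A₁ ℕ.* β′) (e ℕ.* (α ℕ.* α)) 3
                   (trans (ℕP.*-assoc A₁ β′ 3) (trans (cong (A₁ ℕ.*_) (sym β≡3β′)) (trans A₁β≡3eα² (regroup′ e α))))
        where
        regroup′ : ∀ e α → 3 ℕ.* e ℕ.* (α ℕ.* α) ≡ e ℕ.* (α ℕ.* α) ℕ.* 3
        regroup′ = ℕ-Solver.solve-∀
      β′∣e : β′ ℕD.∣ e
      β′∣e = coprime-divisor coprime-β′α (coprime-divisor coprime-β′α (ℕD.divides A₁ (trans (regroup′ α e) (sym A₁β′≡eα²))))
        where
        regroup′ : ∀ α e → α ℕ.* (α ℕ.* e) ≡ e ℕ.* (α ℕ.* α)
        regroup′ = ℕ-Solver.solve-∀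
      f : ℕ
      f = ℕD._∣_.quotient β′∣e
      e≡fβ′ : e ≡ f ℕ.* β′
      e≡fβ′ = ℕD._∣_.equality β′∣e
      1≤f : 1 ≤ f
      1≤f = 1≤m*n⇒1≤n β′ (subst (1 ≤_) (trans e≡fβ′ (ℕP.*-comm f β′)) (ℕ.>-nonZero⁻¹ e))
      A₁≡fα² : A₁ ≡ f ℕ.* (α ℕ.* α)
      A₁≡fα² = ℕP.*-cancelʳ-≡ A₁ (f ℕ.* (α ℕ.* α)) β′ {{ℕ.>-nonZero 1≤β′}}
                 (trans A₁β′≡eα² (trans (cong (λ u → u ℕ.* (α ℕ.* α)) e≡fβ′) (regroup′ f β′ α)))
        where
        regroup′ : ∀ f β′ α → f ℕ.* β′ ℕ.* (α ℕ.* α) ≡ f ℕ.* (α ℕ.* α) ℕ.* β′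
        regroup′ = ℕ-Solver.solve-∀
      A₂≡3fβ′² : A₂ ≡ 3 ℕ.* f ℕ.* (β′ ℕ.* β′)
      A₂≡3fβ′² = trans A₂≡βe (trans (cong₂ ℕ._*_ β≡3β′ e≡fβ′) (regroup′ f β′))
        where
        regroup′ : ∀ f β′ → β′ ℕ.* 3 ℕ.* (f ℕ.* β′) ≡ 3 ℕ.* f ℕ.* (β′ ℕ.* β′)
        regroup′ = ℕ-Solver.solve-∀
      regroup : ∀ α f β′ → α ℕ.* (f ℕ.* β′) ≡ f ℕ.* β′ ℕ.* α
      regroup = ℕ-Solver.solve-∀

  norm-split : NormSplit k N
  norm-split with 3 ℕD.∣? β
  ... | yes (ℕD.divides β′ β≡3β′) = split-3∣β β′ β≡3β′
  ... | no  3∤β                = split-3∤β 3∤β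

reduced-basis-formula : ∀ {N} → ReducedBasis N → InFormulaSet N
reduced-basis-formula {N} B =
  norm-split-formula (norm-split (norm-parallelogram x y norm-x≡y) A₁A₂≡3N² norm-x≤- norm-x≤+ 1≤N) (x , ‖‖²≡norm x)
  where
  open ReducedBasis B
  D : ℤ
  D = det x y
  A₁A₂≡3N² : norm (x -V y) ℕ.* norm (x +V y) ≡ 3 ℕ.* (N ℕ.* N)
  A₁A₂≡3N² = ℤP.+-injective (begin
    + (norm (x -V y) ℕ.* norm (x +V y))               ≡⟨ ℤP.pos-* (norm (x -V y)) (norm (x +V y)) ⟩
    + norm (x -V y) * + norm (x +V y)                 ≡⟨ sym (cong₂ _*_ (‖‖²≡norm (x -V y)) (‖‖²≡norm (x +V y))) ⟩
    ‖ x -V y ‖² * ‖ x +V y ‖²                         ≡⟨ ‖x-y‖²*‖x+y‖² x y ⟩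
    (‖ x ‖² - ‖ y ‖²) * (‖ x ‖² - ‖ y ‖²) + + 3 * (D * D) ≡⟨ cong (λ a → (a - ‖ y ‖²) * (a - ‖ y ‖²) + + 3 * (D * D)) (‖x‖²≡‖y‖² B) ⟩
    (‖ y ‖² - ‖ y ‖²) * (‖ y ‖² - ‖ y ‖²) + + 3 * (D * D) ≡⟨ cancel ‖ y ‖² D ⟩
    + 3 * (D * D)                                     ≡⟨ cong (+ 3 *_) (trans (i*i≡∣i∣*∣i∣ D) (cong (λ n → + (n ℕ.* n)) ∣det∣≡N)) ⟩
    + 3 * + (N ℕ.* N)                                 ≡⟨ sym (ℤP.pos-* 3 (N ℕ.* N)) ⟩
    + (3 ℕ.* (N ℕ.* N))                               ∎)
    where
    open ≡-Reasoning
    cancel : ∀ a D → (a - a) * (a - a) + + 3 * (D * D) ≡ + 3 * (D * D)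
    cancel = ℤ-Solver.solve-∀
  1≤N : 1 ≤ N
  1≤N = subst (1 ≤_) ∣det∣≡N (ℕ.>-nonZero⁻¹ ℤ.∣ D ∣ {{ℤ.≢-nonZero det≢0}})

IsNorm-product : ∀ ps → All Prime ps → All (λ p → p % 3 ≡ 1) ps → IsNorm (product ps)
IsNorm-product []       []           []         = IsNorm-1
IsNorm-product (p ∷ ps) (pr ∷ primes) (≡1 ∷ ≡1s) = IsNorm-* (prime≡1⇒IsNorm pr ≡1) (IsNorm-product ps primes ≡1s)

Admissible⇒IsNorm : ∀ {G} → Admissible G → IsNorm G
Admissible⇒IsNorm (u , j , d , u≤1 , _ , _ , d-ok , refl) = IsNorm-* (IsNorm-* (IsNorm-3^ u≤1) (IsNorm-square j)) (IsNorm-d d-ok)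
  where
  IsNorm-3^ : ∀ {u} → u ≡ 0 ⊎ u ≡ 1 → IsNorm (3 ℕ.^ u)
  IsNorm-3^ (inj₁ refl) = IsNorm-1
  IsNorm-3^ (inj₂ refl) = IsNorm-3
  IsNorm-d : ∀ {d} → DistinctPrimes1mod3Product d → IsNorm d
  IsNorm-d (inj₁ refl)                          = IsNorm-1
  IsNorm-d (inj₂ (ps , primes , _ , ≡1s , refl)) = IsNorm-product ps primes ≡1s

module _ {G} (g : V) (‖g‖²≡G : ‖ g ‖² ≡ + G) (1≤G : 1 ≤ G) (n r : ℕ) (1≤n : 1 ≤ n) (r≤n : r ≤ n) where

  private
    w : V
    w = (+ n + + r , + n)
    K : ℕ
    K = n ℕ.* n ℕ.+ n ℕ.* r ℕ.+ r ℕ.* r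
    T : ℕ
    T = n ℕ.+ 2 ℕ.* r
    +K : + n * + n + + n * + r + + r * + r ≡ + K
    +K = sym (trans (ℤP.pos-+ (n ℕ.* n ℕ.+ n ℕ.* r) (r ℕ.* r))
           (cong₂ _+_ (trans (ℤP.pos-+ (n ℕ.* n) (n ℕ.* r)) (cong₂ _+_ (ℤP.pos-* n n) (ℤP.pos-* n r))) (ℤP.pos-* r r)))
    +T : + n + + 2 * + r ≡ + T
    +T = sym (trans (ℤP.pos-+ n (2 ℕ.* r)) (cong (λ a → + n + a) (ℤP.pos-* 2 r)))

    ‖w‖² : ‖ w ‖² ≡ + K
    ‖w‖² = trans (identity (+ n) (+ r)) +K
      where
      identity : ∀ n r → (n + r) * (n + r) - (n + r) * n + n * n ≡ n * n + n * r + r * r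
      identity = ℤ-Solver.solve-∀
    ‖conj-w-w‖² : ‖ conj w -V w ‖² ≡ + (3 ℕ.* (n ℕ.* n))
    ‖conj-w-w‖² = trans (identity (+ n) (+ r)) (sym (trans (ℤP.pos-* 3 (n ℕ.* n)) (cong (+ 3 *_) (ℤP.pos-* n n))))
      where
      identity : ∀ n r → ((n + r - n) - (n + r)) * ((n + r - n) - (n + r)) - ((n + r - n) - (n + r)) * (- n - n) + (- n - n) * (- n - n)
                         ≡ + 3 * (n * n)
      identity = ℤ-Solver.solve-∀
    ‖conj-w+w‖² : ‖ conj w +V w ‖² ≡ + (T ℕ.* T)
    ‖conj-w+w‖² = trans (identity (+ n) (+ r)) (trans (cong₂ _*_ +T +T) (sym (ℤP.pos-* T T)))
      where
      identity : ∀ n r → ((n + r - n) + (n + r)) * ((n + r - n) + (n + r)) - ((n + r - n) + (n + r)) * (- n + n) + (- n + n) * (- n + n)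
                         ≡ (n + + 2 * r) * (n + + 2 * r)
      identity = ℤ-Solver.solve-∀
    det-conj-w-w : det (conj w) w ≡ + (T ℕ.* n)
    det-conj-w-w = trans (identity (+ n) (+ r)) (trans (cong (_* + n) +T) (sym (ℤP.pos-* T n)))
      where
      identity : ∀ n r → (n + r - n) * n - (- n) * (n + r) ≡ (n + + 2 * r) * n
      identity = ℤ-Solver.solve-∀

    norm-g* : ∀ v {c} → ‖ v ‖² ≡ + c → norm (g *V v) ≡ G ℕ.* c
    norm-g* v {c} ‖v‖²≡c = cong ℤ.∣_∣ (trans (‖*V‖² g v) (trans (cong₂ _*_ ‖g‖²≡G ‖v‖²≡c) (sym (ℤP.pos-* G c))))

    K≤3n² : K ≤ 3 ℕ.* (n ℕ.* n)
    K≤3n² = subst (K ≤_) (triple n) (ℕP.+-mono-≤ (ℕP.+-monoʳ-≤ (n ℕ.* n) (ℕP.*-monoʳ-≤ n r≤n)) (ℕP.*-mono-≤ r≤n r≤n))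
      where
      triple : ∀ n → n ℕ.* n ℕ.+ n ℕ.* n ℕ.+ n ℕ.* n ≡ 3 ℕ.* (n ℕ.* n)
      triple = ℕ-Solver.solve-∀
    K≤T² : K ≤ T ℕ.* T
    K≤T² = subst (K ≤_) (expand n r) (ℕP.m≤m+n K (3 ℕ.* (n ℕ.* r) ℕ.+ 3 ℕ.* (r ℕ.* r)))
      where
      expand : ∀ n r → n ℕ.* n ℕ.+ n ℕ.* r ℕ.+ r ℕ.* r ℕ.+ (3 ℕ.* (n ℕ.* r) ℕ.+ 3 ℕ.* (r ℕ.* r))
                       ≡ (n ℕ.+ 2 ℕ.* r) ℕ.* (n ℕ.+ 2 ℕ.* r)
      expand = ℕ-Solver.solve-∀

  eisenstein-reduced-basis : ReducedBasis (G ℕ.* (T ℕ.* n))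
  eisenstein-reduced-basis = record
    { x         = g *V conj w
    ; y         = g *V w
    ; det≢0     = λ det≡0 → ℕP.<⇒≢ 1≤GTn (sym (ℤP.+-injective (trans (sym det≡) det≡0)))
    ; ∣det∣≡N   = cong ℤ.∣_∣ det≡
    ; norm-x≡y  = trans norm-x (sym norm-y)
    ; norm-x≤-  = subst₂ _≤_ (sym norm-x) (sym norm-x-y) (ℕP.*-monoʳ-≤ G K≤3n²)
    ; norm-x≤+  = subst₂ _≤_ (sym norm-x) (sym norm-x+y) (ℕP.*-monoʳ-≤ G K≤T²)
    }
    where
    det≡ : det (g *V conj w) (g *V w) ≡ + (G ℕ.* (T ℕ.* n))
    det≡ = trans (det-*V g (conj w) w) (trans (cong₂ _*_ ‖g‖²≡G det-conj-w-w) (sym (ℤP.pos-* G (T ℕ.* n))))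
    1≤GTn : 1 ≤ G ℕ.* (T ℕ.* n)
    1≤GTn = ℕP.*-mono-≤ 1≤G (ℕP.*-mono-≤ (ℕP.≤-trans 1≤n (ℕP.m≤m+n n (2 ℕ.* r))) 1≤n)
    norm-x : norm (g *V conj w) ≡ G ℕ.* K
    norm-x = norm-g* (conj w) (trans (‖conj‖² w) ‖w‖²)
    norm-y : norm (g *V w) ≡ G ℕ.* K
    norm-y = norm-g* w ‖w‖²
    norm-x-y : norm ((g *V conj w) -V (g *V w)) ≡ G ℕ.* (3 ℕ.* (n ℕ.* n))
    norm-x-y = trans (cong norm (*V-distrib--V g (conj w) w)) (norm-g* (conj w -V w) ‖conj-w-w‖²)
    norm-x+y : norm ((g *V conj w) +V (g *V w)) ≡ G ℕ.* (T ℕ.* T)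
    norm-x+y = trans (cong norm (*V-distrib-+V g (conj w) w)) (norm-g* (conj w +V w) ‖conj-w+w‖²)

Admissible⇒≥1 : ∀ {G} → Admissible G → 1 ≤ G
Admissible⇒≥1 (u , j , d , u≤1 , 1≤j , 1≤d , _ , refl) = ℕP.*-mono-≤ (ℕP.*-mono-≤ (1≤3^ u≤1) (ℕP.*-mono-≤ 1≤j 1≤j)) 1≤d
  where
  1≤3^ : ∀ {u} → u ≡ 0 ⊎ u ≡ 1 → 1 ≤ 3 ℕ.^ u
  1≤3^ (inj₁ refl) = s≤s z≤n
  1≤3^ (inj₂ refl) = s≤s z≤n

formula⇒reduced-basis : ∀ {N} → InFormulaSet N → ReducedBasis N
formula⇒reduced-basis {N} (u , j , d , m , n , u≤1 , 1≤j , 1≤d , _ , 1≤n , d-ok , _ , _ , n≤m , m≤2n , N≡) =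
  subst ReducedBasis (sym N≡GTn) (eisenstein-reduced-basis (proj₁ G-norm) (proj₂ G-norm) (Admissible⇒≥1 G-admissible) n r 1≤n r≤n)
  where
  G : ℕ
  G = 3 ℕ.^ u ℕ.* (j ℕ.* j) ℕ.* d
  G-admissible : Admissible G
  G-admissible = u , j , d , u≤1 , 1≤j , 1≤d , d-ok , refl
  G-norm : IsNorm G
  G-norm = Admissible⇒IsNorm G-admissible
  r : ℕ
  r = m ∸ n
  r≤n : r ≤ n
  r≤n = subst (r ≤_) (trans (cong (_∸ n) (double n)) (ℕP.m+n∸m≡n n n)) (ℕP.∸-monoˡ-≤ n m≤2n)
    where
    double : ∀ n → 2 ℕ.* n ≡ n ℕ.+ n
    double = ℕ-Solver.solve-∀
  2m-n≡n+2r : 2 ℕ.* m ∸ n ≡ n ℕ.+ 2 ℕ.* r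
  2m-n≡n+2r = trans (cong (λ a → 2 ℕ.* a ∸ n) (sym (ℕP.m+[n∸m]≡n n≤m)))
                (trans (cong (_∸ n) (regroup n r)) (ℕP.m+n∸m≡n n (n ℕ.+ 2 ℕ.* r)))
    where
    regroup : ∀ n r → 2 ℕ.* (n ℕ.+ r) ≡ n ℕ.+ (n ℕ.+ 2 ℕ.* r)
    regroup = ℕ-Solver.solve-∀
  N≡GTn : N ≡ G ℕ.* ((n ℕ.+ 2 ℕ.* r) ℕ.* n)
  N≡GTn = trans N≡ (trans (cong (λ a → G ℕ.* a ℕ.* n) 2m-n≡n+2r) (ℕP.*-assoc G _ n))

corollary4p10 : (N : ℕ) → InIndexSet N ⇔ InFormulaSet N
corollary4p10 N = mk⇔ (λ Γ → reduced-basis-formula (well-rounded⇒reduced-basis Γ))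
                      (λ formula → reduced-basis-index (formula⇒reduced-basis formula))
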